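{- Under the LRU stack model with a stack-depth distribution $s$ on $\{1,\dots,V\}$ that is non-decreasing ($s(j)\le s(j+1)$ for $1\le j\le V-1$), for any buffer capacity $C$, any finite horizon $\tau\ge1$ and any initial buffer content, the MRU policy minimizes the expected number of misses among the first $\tau$ accesses, over all eviction policies.
   Context: LRU stack model: $V$ items; the LRU stack $\Lambda_t$ lists items in order of most recent access ($\Lambda_t(1)$ most recent); the next access is $a_{t+1}=\Lambda_t(d_t)$ with $d_0,d_1,\dots$ i.i.d., $\Pr[d_t=j]=s(j)$; $\Lambda_{t+1}$ is obtained by moving $\Lambda_t(d_t)$ to the top and shifting positions $1,\dots,d_t-1$ down by one; the initial stack is given. A buffer of capacity $C$ holds at most $C$ items; an access to an item not in the buffer is a miss, the item is brought in and, if the buffer was full, the eviction policy evicts a buffered item other than the accessed one. Eviction policies may depend on time, the current state and the current access. MRU (Most Recently Used) evicts, among the buffered items other than the one just accessed, the most recently accessed one. -}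

module Defs where

open import Data.Nat as ℕ using (ℕ; zero; suc)
open import Data.Nat.Properties using (_<?_)
open import Data.Fin using (Fin; zero; suc; toℕ; inject₁)
open import Data.Fin.Subset using (Subset; ∣_∣)
open import Data.Vec using (lookup; _[_]≔_)
open import Data.Bool using (Bool; true; false; if_then_else_)
open import Data.Product using (_×_; _,_)
open import Data.Rational using (ℚ; 0ℚ; 1ℚ; _+_; _*_; _≤_)
open import Data.Fin.Subset using (_∈_; _∉_)
import Data.Fin as Fin
open import Data.List using (List; []; _∷_; allFin)

open import Data.Bool using (_∧_; not)
open import Relation.Binary.PropositionalEquality using (_≡_; _≢_)
open import Relation.Nullary.Decidable using (does)

-- An LRU stack is a map  position ↦ item,
-- position 0 (i.e. Fin index zero) being the top = most recently accessed.
-- Stack depth j ∈ {1,…,V} of the paper is represented by the index j-1 : Fin V.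
Stack : ℕ → Set
Stack V = Fin V → Fin V

-- Moving Λ(d) to the top and shifting positions 1,…,d-1 (paper numbering)
-- down by one.
moveToFront : ∀ {V} → Stack V → Fin V → Stack V
moveToFront {suc n} σ d zero    = σ d
moveToFront {suc n} σ d (suc j) =
  if does (toℕ j <? toℕ d) then σ (inject₁ j) else σ (suc j)

Buffer : ℕ → Set
Buffer V = Subset V

-- An eviction policy: given the time t, the current state (LRU stack Λ_t and
-- buffer content) and the currently accessed item, returns the item to evict
-- (only consulted on a miss with a full buffer).
Policy : ℕ → Set
Policy V = ℕ → Stack V → Buffer V → Fin V → Fin V

-- MRU: scan the stack from the top (positions in increasing order) and return
-- the first buffered item other than the accessed one, i.e. the most recently
-- accessed buffered item other than the current access.  (Default: the accessed
-- item itself, which only occurs if no such item exists.)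
scanMRU : ∀ {V} → Stack V → Buffer V → Fin V → List (Fin V) → Fin V
scanMRU σ B a []       = a
scanMRU σ B a (p ∷ ps) =
  if lookup B (σ p) ∧ not (does (σ p Fin.≟ a)) then σ p else scanMRU σ B a ps

MRU : ∀ {V} → Policy V
MRU {V} t σ B a = scanMRU σ B a (allFin V)

step : ∀ {V} → ℕ → Policy V → ℕ → Stack V → Buffer V → Fin V →
       ℚ × Stack V × Buffer V
step C π t σ B d =
  let a  = σ d
      σ' = moveToFront σ d
  in if lookup B a then (0ℚ , σ' , B)
     else if does (∣ B ∣ <? C) then (1ℚ , σ' , (B [ a ]≔ true))
     else (1ℚ , σ' , ((B [ π t σ B a ]≔ false) [ a ]≔ true))

sumFin : ∀ {V} → (Fin V → ℚ) → ℚ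
sumFin {zero}  f = 0ℚ
sumFin {suc V} f = f zero + sumFin (λ i → f (suc i))

expMisses : ∀ {V} → (Fin V → ℚ) → ℕ → Policy V → ℕ → ℕ → Stack V → Buffer V → ℚ
expMisses s C π zero    t σ B = 0ℚ
expMisses s C π (suc k) t σ B = sumFin λ d →
  let (m , σ' , B') = step C π t σ B d
  in s d * (m + expMisses s C π k (suc t) σ' B')

ValidPolicy : ∀ {V} → ℕ → Policy V → Set
ValidPolicy {V} C π = ∀ (t : ℕ) (σ : Stack V) (B : Buffer V) (a : Fin V) →
  ∣ B ∣ ≡ C → a ∉ B → (π t σ B a ∈ B) × (π t σ B a ≢ a)

IsDistribution : ∀ {V} → (Fin V → ℚ) → Set
IsDistribution s = (∀ j → 0ℚ ≤ s j) × (sumFin s ≡ 1ℚ)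

NonDecreasing : ∀ {V} → (Fin V → ℚ) → Set
NonDecreasing {V} s = ∀ (j k : Fin V) → toℕ k ≡ suc (toℕ j) → s j ≤ s k

{-# OPTIONS --safe #-}
module Submission where

-- What matters for the future is the occupancy pattern along the LRU stack: which stack depths hold
-- buffered items.  Let cost k n P be the expected number of misses of MRU in k accesses from a
-- pattern P holding n items.  By induction on k, cost k satisfies four monotonicity properties:
-- moving a buffered item one depth deeper does not increase it (deeper depths are at least as
-- likely to be accessed, as s is non-decreasing); inserting an item while there is room does not
-- increase it; and inserting or replacing a single item decreases it by at most one.  MRU evicts
-- the shallowest buffered item, so by the first property its eviction is the best single eviction
-- from a full buffer.  Following an arbitrary policy access by access therefore costs at least
-- cost k n P in expectation, while MRU costs at most that.

open import Algebra.Bundles using (CommutativeMonoid)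
open import Data.Bool using (Bool; true; false; if_then_else_; not)
open import Data.Empty using (⊥-elim)
open import Data.Fin using (Fin; zero; suc; toℕ; fromℕ<; inject₁; punchOut) renaming (_≟_ to _≟ᶠ_)
open import Data.Fin.Properties
  using (toℕ<n; toℕ-injective; toℕ-fromℕ<; fromℕ<-toℕ; toℕ-inject₁; suc-injective; any?; pigeonhole; punchOut-injective)
open import Data.Fin.Subset using (∣_∣; ⊥; _∈_)
open import Data.Fin.Subset.Properties using (nonempty?; Empty-unique; ∣⊥∣≡0; ∉⊥)
open import Data.List using (tabulate)
import Data.Nat as ℕ
open import Data.Nat using (ℕ; zero; suc; _<_; _≤_; z≤n; s≤s; _≡ᵇ_; _<ᵇ_; _≟_; _<?_)
import Data.Nat.Properties as ℕₚ
open import Data.Nat.Properties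
  using (<-cmp; <-irrefl; <-asym; <-trans; ≤-<-trans; <-≤-trans; n<1+n; m<n⇒m<1+n; ≤⇒≯; ≮⇒≥; ≤∧≢⇒<; <⇒≢; >⇒≢; <⇒≤;
         ≤-pred; ≤-antisym; m≤n⇒m<n∨m≡n; 1+n≢n; +-identityʳ; +-suc)
open import Data.Product using (∃; _×_; _,_; proj₁; proj₂)
open import Data.Rational using (ℚ; 0ℚ; 1ℚ; _+_; _*_; _-_; -_; nonNegative) renaming (_≤_ to _≤ℚ_)
open import Data.Rational.Properties
  using (module ≤-Reasoning; ≤-refl; ≤-reflexive; +-mono-≤; +-monoˡ-≤; +-monoʳ-≤; +-identityˡ; +-assoc; +-comm; +-inverseʳ;
         *-identityʳ; *-distribˡ-+; *-monoˡ-≤-nonNeg; *-monoʳ-≤-nonNeg; nonNegative⁻¹; +-0-commutativeMonoid)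
open import Data.Rational.Solver using (module +-*-Solver)
open import Data.Sum using (inj₁; inj₂)
open import Data.Vec using (_∷_; lookup; _[_]≔_)
open import Data.Vec.Properties using (lookup∘update; lookup∘update′; []=⇒lookup)
open import Function using (_∘_; id)
open import Function.Definitions using (Injective)
open import Relation.Binary.Definitions using (tri<; tri≈; tri>)
open import Relation.Binary.PropositionalEquality
open import Relation.Nullary using (¬_; Dec; yes; no; does; proof; ofʸ; ofⁿ; contradiction)
open import Relation.Nullary.Decidable using (dec-false)
open import Algebra.Properties.CommutativeSemigroup
  (CommutativeMonoid.commutativeSemigroup +-0-commutativeMonoid)
  using (interchange; xy∙z≈xz∙y)
open import Defs

-- Occupancy patterns

Occupancy : Set
Occupancy = ℕ → Bool

set : Occupancy → ℕ → Bool → Occupancy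
set P x b j = if j ≡ᵇ x then b else P j

-- proof (j ≟ x) reflects j ≡ x in the very boolean j ≡ᵇ x that set tests.
set-≡ : ∀ P x b → set P x b x ≡ b
set-≡ P x b with x ≡ᵇ x | proof (x ≟ x)
... | _ | ofʸ _   = refl
... | _ | ofⁿ x≢x = ⊥-elim (x≢x refl)

set-≢ : ∀ P x b {j} → j ≢ x → set P x b j ≡ P j
set-≢ P x b {j} j≢x with j ≡ᵇ x | proof (j ≟ x)
... | _ | ofʸ j≡x = ⊥-elim (j≢x j≡x)
... | _ | ofⁿ _   = refl

set-cong : ∀ {P Q} x b → P ≗ Q → set P x b ≗ set Q x b
set-cong x b P≗Q j with j ≡ᵇ x
... | true  = refl
... | false = P≗Q j

set-comm : ∀ P {x y} a b → x ≢ y → set (set P x a) y b ≗ set (set P y b) x a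
set-comm P {x} {y} a b x≢y j with j ≡ᵇ x | proof (j ≟ x) | j ≡ᵇ y | proof (j ≟ y)
... | _ | ofʸ refl | _ | ofʸ refl = ⊥-elim (x≢y refl)
... | _ | ofʸ _    | _ | ofⁿ _    = refl
... | _ | ofⁿ _    | _ | ofʸ _    = refl
... | _ | ofⁿ _    | _ | ofⁿ _    = refl

set-set : ∀ P x a b → set (set P x a) x b ≗ set P x b
set-set P x a b j with j ≡ᵇ x
... | true  = refl
... | false = refl

set-id : ∀ {P x b} → P x ≡ b → set P x b ≗ P
set-id {P} {x} Px≡b j with j ≡ᵇ x | proof (j ≟ x)
... | _ | ofʸ refl = sym Px≡b
... | _ | ofⁿ _    = refl

set-set-id : ∀ P {x} a {b} → P x ≡ b → set (set P x a) x b ≗ P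
set-set-id P {x} a {b} Px j = trans (set-set P x a b j) (set-id Px j)

data Mark (b : Bool) : Set where
  marked   : b ≡ true  → Mark b
  unmarked : b ≡ false → Mark b

mark? : ∀ b → Mark b
mark? true  = marked refl
mark? false = unmarked refl

marked≢unmarked : ∀ (P : Occupancy) {a b} → P a ≡ true → P b ≡ false → a ≢ b
marked≢unmarked P Pa Pb a≡b with () ← trans (sym Pb) (trans (cong P (sym a≡b)) Pa)

move : Occupancy → ℕ → ℕ → Occupancy
move P y x = set (set P y false) x true

move-cong : ∀ {P Q} y x → P ≗ Q → move P y x ≗ move Q y x
move-cong y x P≗Q = set-cong x true (set-cong y false P≗Q)

move-to : ∀ P y x → move P y x x ≡ true
move-to P y x = set-≡ (set P y false) x true

move-from : ∀ P {y x} → y ≢ x → move P y x y ≡ false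
move-from P {y} {x} y≢x = trans (set-≢ (set P y false) x true y≢x) (set-≡ P y false)

move-other : ∀ P {y x j} → j ≢ y → j ≢ x → move P y x j ≡ P j
move-other P {y} {x} j≢y j≢x = trans (set-≢ (set P y false) x true j≢x) (set-≢ P y false j≢y)

move-set-comm : ∀ P {m y d} → m ≢ y → m ≢ d → d ≢ y → move (set P y true) m d ≗ move (set P d true) m y
move-set-comm P {m} {y} {d} m≢y m≢d d≢y j = begin
  set (set (set P y true) m false) d true j
    ≡⟨ set-cong d true (set-comm P true false (m≢y ∘ sym)) j ⟩
  set (set (set P m false) y true) d true j
    ≡⟨ set-comm (set P m false) true true (d≢y ∘ sym) j ⟩
  set (set (set P m false) d true) y true j
    ≡⟨ set-cong y true (set-comm P false true m≢d) j ⟩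
  set (set (set P d true) m false) y true j ∎
  where open ≡-Reasoning

set-move : ∀ P {y} x → P y ≡ true → x ≢ y → set (move P y x) y true ≗ set P x true
set-move P {y} x Py x≢y j = begin
  set (set (set P y false) x true) y true j
    ≡⟨ set-comm (set P y false) true true x≢y j ⟩
  set (set (set P y false) y true) x true j
    ≡⟨ set-cong x true (set-set-id P false Py) j ⟩
  set P x true j ∎
  where open ≡-Reasoning

set-move-comm : ∀ P {y x d} b → d ≢ y → d ≢ x → set (move P y x) d b ≗ move (set P d b) y x
set-move-comm P {y} {x} {d} b d≢y d≢x j = begin
  set (set (set P y false) x true) d b j
    ≡⟨ set-comm (set P y false) true b (d≢x ∘ sym) j ⟩
  set (set (set P y false) d b) x true j
    ≡⟨ set-cong x true (set-comm P false b (d≢y ∘ sym)) j ⟩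
  set (set (set P d b) y false) x true j ∎
  where open ≡-Reasoning

move-move-comm : ∀ P {y x m d} → m ≢ y → m ≢ x → d ≢ y → d ≢ x →
                 move (move P y x) m d ≗ move (move P m d) y x
move-move-comm P {y} {x} {m} {d} m≢y m≢x d≢y d≢x j = begin
  set (set (move P y x) m false) d true j
    ≡⟨ set-cong d true (set-move-comm P false m≢y m≢x) j ⟩
  set (move (set P m false) y x) d true j
    ≡⟨ set-move-comm (set P m false) true d≢y d≢x j ⟩
  move (move P m d) y x j ∎
  where open ≡-Reasoning

move-move : ∀ P {y x} d → P x ≡ false → x ≢ y → move (move P y x) x d ≗ move P y d
move-move P {y} {x} d Px x≢y = set-cong d true (set-set-id (set P y false) true (trans (set-≢ P y false x≢y) Px))

move-via : ∀ P {m e d} → P e ≡ true → m ≢ e → m ≢ d → e ≢ d → move P m d ≗ move (move P e d) m e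
move-via P {m} {e} {d} Pe m≢e m≢d e≢d j
  with j ≡ᵇ e | proof (j ≟ e) | j ≡ᵇ m | proof (j ≟ m) | j ≡ᵇ d | proof (j ≟ d)
... | _ | ofʸ refl | _ | ofʸ refl | _ | _        = ⊥-elim (m≢e refl)
... | _ | ofʸ refl | _ | ofⁿ _    | _ | ofʸ refl = ⊥-elim (e≢d refl)
... | _ | ofʸ refl | _ | ofⁿ _    | _ | ofⁿ _    = Pe
... | _ | ofⁿ _    | _ | ofʸ refl | _ | ofʸ refl = ⊥-elim (m≢d refl)
... | _ | ofⁿ _    | _ | ofʸ refl | _ | ofⁿ _    = refl
... | _ | ofⁿ _    | _ | ofⁿ _    | _ | ofʸ _    = refl
... | _ | ofⁿ _    | _ | ofⁿ _    | _ | ofⁿ _    = refl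

move-move-back : ∀ P {y x m} → P y ≡ true → m ≢ y → m ≢ x → x ≢ y → move (move P y x) m y ≗ move P m x
move-move-back P {y} {x} {m} Py m≢y m≢x x≢y j
  with j ≡ᵇ y | proof (j ≟ y) | j ≡ᵇ m | proof (j ≟ m) | j ≡ᵇ x | proof (j ≟ x)
... | _ | ofʸ refl | _ | ofʸ refl | _ | _        = ⊥-elim (m≢y refl)
... | _ | ofʸ refl | _ | ofⁿ _    | _ | ofʸ refl = ⊥-elim (x≢y refl)
... | _ | ofʸ refl | _ | ofⁿ _    | _ | ofⁿ _    = sym Py
... | _ | ofⁿ _    | _ | ofʸ refl | _ | ofʸ refl = ⊥-elim (m≢x refl)
... | _ | ofⁿ _    | _ | ofʸ refl | _ | ofⁿ _    = refl
... | _ | ofⁿ _    | _ | ofⁿ _    | _ | ofʸ _    = refl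
... | _ | ofⁿ _    | _ | ofⁿ _    | _ | ofⁿ _    = refl

-- Stack depths under move-to-front

-- before d j is the depth, before depth d is accessed, of the item found at depth j afterwards;
-- after d is its inverse.
before : ℕ → ℕ → ℕ
before d zero    = d
before d (suc j) with j <? d
... | yes _ = j
... | no  _ = suc j

after : ℕ → ℕ → ℕ
after d x with x ≟ d
... | yes _ = 0
... | no  _ with x <? d
...   | yes _ = suc x
...   | no  _ = x

before-< : ∀ {d j} → j < d → before d (suc j) ≡ j
before-< {d} {j} j<d with j <? d
... | yes _   = refl
... | no  j≮d = ⊥-elim (j≮d j<d)

before-≮ : ∀ {d j} → ¬ j < d → before d (suc j) ≡ suc j
before-≮ {d} {j} j≮d with j <? d
... | yes j<d = ⊥-elim (j≮d j<d)
... | no  _   = refl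

after-≡ : ∀ d → after d d ≡ 0
after-≡ d with d ≟ d
... | yes _   = refl
... | no  d≢d = ⊥-elim (d≢d refl)

after-< : ∀ {d x} → x < d → after d x ≡ suc x
after-< {d} {x} x<d with x ≟ d
... | yes x≡d = ⊥-elim (<⇒≢ x<d x≡d)
... | no  _ with x <? d
...   | yes _   = refl
...   | no  x≮d = ⊥-elim (x≮d x<d)

after-> : ∀ {d x} → d < x → after d x ≡ x
after-> {d} {x} d<x with x ≟ d
... | yes x≡d = ⊥-elim (<⇒≢ d<x (sym x≡d))
... | no  _ with x <? d
...   | yes x<d = ⊥-elim (<-asym d<x x<d)
...   | no  _   = refl

before-after : ∀ d x → before d (after d x) ≡ x
before-after d x with <-cmp x d
... | tri< x<d _ _ rewrite after-< x<d = before-< x<d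
... | tri≈ _ refl _ rewrite after-≡ x = refl
before-after d (suc x) | tri> _ _ d<sx@(s≤s d≤x) rewrite after-> d<sx = before-≮ (≤⇒≯ d≤x)

after-before : ∀ d j → after d (before d j) ≡ j
after-before d zero = after-≡ d
after-before d (suc j) with j <? d
... | yes j<d = after-< j<d
... | no  j≮d = after-> (s≤s (≮⇒≥ j≮d))

before-injective : ∀ d {i j} → before d i ≡ before d j → i ≡ j
before-injective d {i} {j} eq = trans (sym (after-before d i)) (trans (cong (after d) eq) (after-before d j))

after-bound : ∀ {V} d x → d < V → x < V → after d x < V
after-bound d x d<V x<V with <-cmp x d
... | tri< x<d _ _ rewrite after-< x<d = ≤-<-trans x<d d<V
... | tri≈ _ refl _ rewrite after-≡ x = ≤-<-trans z≤n d<V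
... | tri> _ _ d<x rewrite after-> d<x = x<V

after-mono-< : ∀ d {x y} → x < y → x ≢ d → y ≢ d → after d x < after d y
after-mono-< d {x} {y} x<y x≢d y≢d with <-cmp x d | <-cmp y d
... | tri< x<d _ _ | tri< y<d _ _ rewrite after-< x<d | after-< y<d = s≤s x<y
... | tri< x<d _ _ | tri> _ _ d<y rewrite after-< x<d | after-> d<y = ≤-<-trans x<d d<y
... | tri> _ _ d<x | tri> _ _ d<y rewrite after-> d<x | after-> d<y = x<y
... | tri> _ _ d<x | tri< y<d _ _ = ⊥-elim (<-asym (<-trans d<x x<y) y<d)
... | tri≈ _ x≡d _ | _ = ⊥-elim (x≢d x≡d)
... | _ | tri≈ _ y≡d _ = ⊥-elim (y≢d y≡d)

after-suc : ∀ d {p} → p ≢ d → suc p ≢ d → after d (suc p) ≡ suc (after d p)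
after-suc d {p} p≢d sp≢d with <-cmp p d
... | tri< p<d _ _ rewrite after-< p<d = after-< (≤∧≢⇒< p<d sp≢d)
... | tri≈ _ p≡d _ = ⊥-elim (p≢d p≡d)
... | tri> _ _ d<p rewrite after-> d<p = after-> (m<n⇒m<1+n d<p)

moveFront : Occupancy → ℕ → Occupancy
moveFront P d = P ∘ before d

moveFront-cong : ∀ {P Q} d → P ≗ Q → moveFront P d ≗ moveFront Q d
moveFront-cong d P≗Q = P≗Q ∘ before d

moveFront-after : ∀ P d x → moveFront P d (after d x) ≡ P x
moveFront-after P d x = cong P (before-after d x)

moveFront-set : ∀ P d x b → moveFront (set P x b) d ≗ set (moveFront P d) (after d x) b
moveFront-set P d x b j with before d j ≡ᵇ x | proof (before d j ≟ x) | j ≡ᵇ after d x | proof (j ≟ after d x)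
... | _ | ofʸ _    | _ | ofʸ _    = refl
... | _ | ofⁿ _    | _ | ofⁿ _    = refl
... | _ | ofʸ refl | _ | ofⁿ j≢   = ⊥-elim (j≢ (sym (after-before d j)))
... | _ | ofⁿ b≢x  | _ | ofʸ refl = ⊥-elim (b≢x (before-after d x))

moveFront-set-after : ∀ P d b {z} → z ≢ d → moveFront (set P d b) d (after d z) ≡ P z
moveFront-set-after P d b {z} z≢d = trans (moveFront-after (set P d b) d z) (set-≢ P d b z≢d)

moveFront-move : ∀ P d y x → moveFront (move P y x) d ≗ move (moveFront P d) (after d y) (after d x)
moveFront-move P d y x j =
  trans (moveFront-set (set P y false) d x true j) (set-cong (after d x) true (moveFront-set P d y false) j)

moveFront-move-adjacent : ∀ R {p d} → p ≢ d → suc p ≢ d →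
                          moveFront (move R p (suc p)) d ≗ move (moveFront R d) (after d p) (suc (after d p))
moveFront-move-adjacent R {p} {d} p≢d sp≢d j =
  trans (moveFront-move R d p (suc p) j) (cong (λ z → move (moveFront R d) (after d p) z j) (after-suc d p≢d sp≢d))

moveFront-after-suc : ∀ R {p d} → p ≢ d → suc p ≢ d → moveFront R d (suc (after d p)) ≡ R (suc p)
moveFront-after-suc R {p} {d} p≢d sp≢d = trans (cong (moveFront R d) (sym (after-suc d p≢d sp≢d)))
    (moveFront-after R d (suc p))

moveFront-swap : ∀ R R′ p → (∀ j → j ≢ p → j ≢ suc p → R′ j ≡ R j) →
                 R′ (suc p) ≡ R p → R′ p ≡ R (suc p) → moveFront R′ (suc p) ≗ moveFront R p
moveFront-swap R R′ p elsewhere at-suc at-p zero = at-suc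
moveFront-swap R R′ p elsewhere at-suc at-p (suc i) with <-cmp i p
... | tri< i<p _ _ rewrite before-< (m<n⇒m<1+n i<p) | before-< i<p =
  elsewhere i (<⇒≢ i<p) (<⇒≢ (m<n⇒m<1+n i<p))
... | tri≈ _ refl _ rewrite before-< (n<1+n i) | before-≮ {i} {i} (<-irrefl refl) = at-p
... | tri> _ _ p<i rewrite before-≮ (≤⇒≯ p<i) | before-≮ (<-asym p<i) =
  elsewhere (suc i) (<⇒≢ (m<n⇒m<1+n p<i) ∘ sym) (<⇒≢ (s≤s p<i) ∘ sym)

moveFront-suc-same : ∀ P p → P (suc p) ≡ P p → moveFront P (suc p) ≗ moveFront P p
moveFront-suc-same P p same = moveFront-swap P P p (λ _ _ _ → refl) same (sym same)

moveFront-suc-move : ∀ P p → P p ≡ true → P (suc p) ≡ false → moveFront (move P p (suc p)) (suc p) ≗ moveFront P p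
moveFront-suc-move P p Pp Psp = moveFront-swap P (move P p (suc p)) p (λ j j≢p j≢sp → move-other P j≢p j≢sp)
  (trans (move-to P p (suc p)) (sym Pp)) (trans (move-from P (<⇒≢ (n<1+n p))) (sym Psp))

firstMarked : Occupancy → ℕ → ℕ → ℕ → ℕ
firstMarked P D zero    i = D
firstMarked P D (suc c) i = if P i then i else firstMarked P D c (suc i)

record FirstMarked (P : Occupancy) (i j m : ℕ) : Set where
  field
    from≤    : i ≤ m
    ≤bound   : m ≤ j
    first-marked : P m ≡ true
    none-before : ∀ {l} → i ≤ l → l < m → P l ≡ false

firstMarked-spec : ∀ P D c i {j} → i ≤ j → j < i ℕ.+ c → P j ≡ true → FirstMarked P i j (firstMarked P D c i)
firstMarked-spec P D zero i i≤j j<i+0 Pj = ⊥-elim (<-irrefl refl (<-≤-trans j<i+0 (subst (_≤ _) (sym (+-identityʳ i)) i≤j)))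
firstMarked-spec P D (suc c) i {j} i≤j j<i+c Pj with P i in Pi
... | true  = record { from≤ = ℕₚ.≤-refl ; ≤bound = i≤j ; first-marked = Pi ; none-before = λ i≤l l<i → ⊥-elim
    (<-irrefl refl (<-≤-trans l<i i≤l)) }
... | false = record { from≤ = <⇒≤ from≤ ; ≤bound = ≤bound ; first-marked = first-marked ; none-before = none-before′ }
  where
  i≢j : i ≢ j
  i≢j refl with () ← trans (sym Pi) Pj
  open FirstMarked (firstMarked-spec P D c (suc i) (≤∧≢⇒< i≤j i≢j) (subst (j <_) (+-suc i c) j<i+c) Pj)
  none-before′ : ∀ {l} → i ≤ l → l < firstMarked P D c (suc i) → P l ≡ false
  none-before′ {l} i≤l l<m with i ≟ l
  ... | yes refl = Pi
  ... | no  i≢l  = none-before (≤∧≢⇒< i≤l i≢l) l<m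

firstMarked-cong : ∀ {P Q} D c i → P ≗ Q → firstMarked P D c i ≡ firstMarked Q D c i
firstMarked-cong D zero    i P≗Q = refl
firstMarked-cong D (suc c) i P≗Q rewrite P≗Q i = cong (if _ then i else_) (firstMarked-cong D c (suc i) P≗Q)

-- Finite sums and expectations

*-monoˡ-≤-nonNeg′ : ∀ r {p q} → 0ℚ ≤ℚ r → p ≤ℚ q → r * p ≤ℚ r * q
*-monoˡ-≤-nonNeg′ r 0≤r = *-monoˡ-≤-nonNeg r {{nonNegative 0≤r}}

rearrangement : ∀ a b u v → a ≤ℚ b → u ≤ℚ v → a * v + b * u ≤ℚ a * u + b * v
rearrangement a b u v a≤b u≤v = begin
  a * v + b * u
    ≡⟨ solve 4 (λ a b u v → a :* v :+ b :* u := (a :* u :+ b :* u) :+ a :* (v :- u)) refl a b u v ⟩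
  (a * u + b * u) + a * (v - u)
    ≤⟨ +-monoʳ-≤ (a * u + b * u) (*-monoʳ-≤-nonNeg (v - u) {{nonNegative 0≤v-u}} a≤b) ⟩
  (a * u + b * u) + b * (v - u)
    ≡⟨ solve 4 (λ a b u v → (a :* u :+ b :* u) :+ b :* (v :- u) := a :* u :+ b :* v) refl a b u v ⟩
  a * u + b * v ∎
  where
  open ≤-Reasoning
  open +-*-Solver
  0≤v-u : 0ℚ ≤ℚ v - u
  0≤v-u = subst (_≤ℚ v - u) (+-inverseʳ u) (+-monoˡ-≤ (- u) u≤v)

sumFin-cong : ∀ {V} {f g : Fin V → ℚ} → (∀ d → f d ≡ g d) → sumFin f ≡ sumFin g
sumFin-cong {zero}  f≡g = refl
sumFin-cong {suc V} f≡g = cong₂ _+_ (f≡g zero) (sumFin-cong (f≡g ∘ suc))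

sumFin-mono-≤ : ∀ {V} {f g : Fin V → ℚ} → (∀ d → f d ≤ℚ g d) → sumFin f ≤ℚ sumFin g
sumFin-mono-≤ {zero}  f≤g = ≤-refl
sumFin-mono-≤ {suc V} f≤g = +-mono-≤ (f≤g zero) (sumFin-mono-≤ (f≤g ∘ suc))

sumFin-+ : ∀ {V} (f g : Fin V → ℚ) → sumFin (λ d → f d + g d) ≡ sumFin f + sumFin g
sumFin-+ {zero}  f g = sym (+-identityˡ 0ℚ)
sumFin-+ {suc V} f g = trans (cong (f zero + g zero +_) (sumFin-+ (f ∘ suc) (g ∘ suc)))
                             (interchange (f zero) (g zero) _ _)

sumFin-exchange : ∀ {V} {f g : Fin V → ℚ} p {x y} → (∀ d → d ≢ p → f d ≤ℚ g d) →
                  f p + x ≤ℚ g p + y → sumFin f + x ≤ℚ sumFin g + y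
sumFin-exchange {suc V} {f} {g} zero {x} {y} f≤g at-p = begin
  (f zero + sumFin (f ∘ suc)) + x
    ≡⟨ xy∙z≈xz∙y (f zero) _ x ⟩
  (f zero + x) + sumFin (f ∘ suc)
    ≤⟨ +-mono-≤ at-p (sumFin-mono-≤ λ d → f≤g (suc d) λ ()) ⟩
  (g zero + y) + sumFin (g ∘ suc)
    ≡⟨ xy∙z≈xz∙y (g zero) y _ ⟩
  (g zero + sumFin (g ∘ suc)) + y ∎
  where open ≤-Reasoning
sumFin-exchange {suc V} {f} {g} (suc p) {x} {y} f≤g at-p = begin
  (f zero + sumFin (f ∘ suc)) + x
    ≡⟨ +-assoc (f zero) _ x ⟩
  f zero + (sumFin (f ∘ suc) + x)
    ≤⟨ +-mono-≤ (f≤g zero λ ()) (sumFin-exchange p (λ d d≢p → f≤g (suc d) (d≢p ∘ suc-injective)) at-p) ⟩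
  g zero + (sumFin (g ∘ suc) + y)
    ≡⟨ +-assoc (g zero) _ y ⟨
  (g zero + sumFin (g ∘ suc)) + y ∎
  where open ≤-Reasoning

sumFin-mono-except₂ : ∀ {V} {f g : Fin V → ℚ} p q → p ≢ q → (∀ d → d ≢ p → d ≢ q → f d ≤ℚ g d) →
                      f p + f q ≤ℚ g p + g q → sumFin f ≤ℚ sumFin g
sumFin-mono-except₂ zero zero p≢q f≤g at-pq = ⊥-elim (p≢q refl)
sumFin-mono-except₂ {f = f} {g} zero (suc q) p≢q f≤g at-pq =
  subst₂ _≤ℚ_ (+-comm (sumFin (f ∘ suc)) (f zero)) (+-comm (sumFin (g ∘ suc)) (g zero))
  (sumFin-exchange q (λ d d≢q → f≤g (suc d) (λ ()) (d≢q ∘ suc-injective))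
    (subst₂ _≤ℚ_ (+-comm (f zero) _) (+-comm (g zero) _) at-pq))
sumFin-mono-except₂ {f = f} {g} (suc p) zero p≢q f≤g at-pq =
  sumFin-mono-except₂ zero (suc p) (p≢q ∘ sym) (λ d d≢0 d≢p → f≤g d d≢p d≢0)
    (subst₂ _≤ℚ_ (+-comm (f (suc p)) _) (+-comm (g (suc p)) _) at-pq)
sumFin-mono-except₂ (suc p) (suc q) p≢q f≤g at-pq =
  +-mono-≤ (f≤g zero (λ ()) (λ ()))
    (sumFin-mono-except₂ p q (p≢q ∘ cong suc) (λ d d≢p d≢q → f≤g (suc d) (d≢p ∘ suc-injective) (d≢q ∘ suc-injective)) at-pq)

expectation-mono-≤ : ∀ {V} {s f g : Fin V → ℚ} → (∀ d → 0ℚ ≤ℚ s d) → (∀ d → f d ≤ℚ g d) →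
                     sumFin (λ d → s d * f d) ≤ℚ sumFin (λ d → s d * g d)
expectation-mono-≤ {s = s} 0≤s f≤g = sumFin-mono-≤ λ d → *-monoˡ-≤-nonNeg′ (s d) (0≤s d) (f≤g d)

expectation-≤-1+ : ∀ {V} {s f g : Fin V → ℚ} → IsDistribution s → (∀ d → f d ≤ℚ 1ℚ + g d) →
                   sumFin (λ d → s d * f d) ≤ℚ 1ℚ + sumFin (λ d → s d * g d)
expectation-≤-1+ {s = s} {f} {g} (0≤s , Σs≡1) f≤1+g = begin
  sumFin (λ d → s d * f d)
    ≤⟨ expectation-mono-≤ 0≤s f≤1+g ⟩
  sumFin (λ d → s d * (1ℚ + g d))
    ≡⟨ sumFin-cong (λ d → *-distribˡ-+ (s d) 1ℚ (g d)) ⟩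
  sumFin (λ d → s d * 1ℚ + s d * g d)
    ≡⟨ sumFin-+ (λ d → s d * 1ℚ) (λ d → s d * g d) ⟩
  sumFin (λ d → s d * 1ℚ) + sumFin (λ d → s d * g d)
    ≡⟨ cong (_+ sumFin (λ d → s d * g d)) (trans (sumFin-cong (*-identityʳ ∘ s)) Σs≡1) ⟩
  1ℚ + sumFin (λ d → s d * g d) ∎
  where open ≤-Reasoning

p≤1+q : ∀ {p q} → p ≤ℚ q → p ≤ℚ 1ℚ + q
p≤1+q {p} p≤q = subst (_≤ℚ _) (+-identityˡ p) (+-mono-≤ (nonNegative⁻¹ 1ℚ) p≤q)

-- The expected cost of MRU on occupancy patterns

module Model (V C : ℕ) (s : Fin V → ℚ) where

  -- The most recently used buffered item is the one at the shallowest marked depth.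
  victim : Occupancy → ℕ → ℕ
  victim P d = firstMarked P d V 0

  victim-spec : ∀ P d {j} → j < V → P j ≡ true → FirstMarked P 0 j (victim P d)
  victim-spec P d j<V Pj = firstMarked-spec P d V 0 z≤n j<V Pj

  victim-unique : ∀ P d {m} → m < V → P m ≡ true → (∀ {l} → l < m → P l ≡ false) → victim P d ≡ m
  victim-unique P d m<V Pm before-m with victim-spec P d m<V Pm
  ... | record { ≤bound = v≤m ; first-marked = Pv } with m≤n⇒m<n∨m≡n v≤m
  ...   | inj₂ v≡m = v≡m
  ...   | inj₁ v<m with () ← trans (sym (before-m v<m)) Pv

  victim-marked : ∀ P d {j} → j < V → P j ≡ true → P (victim P d) ≡ true
  victim-marked P d j<V Pj = FirstMarked.first-marked (victim-spec P d j<V Pj)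

  victim-≤ : ∀ P d {j} → j < V → P j ≡ true → victim P d ≤ j
  victim-≤ P d j<V Pj = FirstMarked.≤bound (victim-spec P d j<V Pj)

  victim-< : ∀ P d {j} → j < V → P j ≡ true → victim P d ≢ j → victim P d < j
  victim-< P d j<V Pj v≢j = ≤∧≢⇒< (victim-≤ P d j<V Pj) v≢j

  victim-bound : ∀ P d {j} → j < V → P j ≡ true → victim P d < V
  victim-bound P d j<V Pj = ≤-<-trans (victim-≤ P d j<V Pj) j<V

  victim-≢ : ∀ P d {j} → P d ≡ false → j < V → P j ≡ true → victim P d ≢ d
  victim-≢ P d Pd j<V Pj v≡d with () ← trans (sym Pd) (trans (cong P (sym v≡d)) (victim-marked P d j<V Pj))

  stepCost : (ℕ → Occupancy → ℚ) → ℕ → Occupancy → ℕ → ℚ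
  stepCost f n P d =
    if P d then f n (moveFront P d)
    else if does (n <? C) then 1ℚ + f (suc n) (moveFront (set P d true) d)
    else 1ℚ + f n (moveFront (move P (victim P d) d) d)

  cost : ℕ → ℕ → Occupancy → ℚ
  cost zero    n P = 0ℚ
  cost (suc k) n P = sumFin λ d → s d * stepCost (cost k) n P (toℕ d)

  stepCost-hit : ∀ f n P d → P d ≡ true → stepCost f n P d ≡ f n (moveFront P d)
  stepCost-hit f n P d Pd rewrite Pd = refl

  -- does (n <? C) normalises to n <ᵇ C, the boolean that with-abstraction finds in the goal.
  stepCost-insert : ∀ f n P d → P d ≡ false → n < C → stepCost f n P d ≡ 1ℚ + f (suc n) (moveFront (set P d true) d)
  stepCost-insert f n P d Pd n<C rewrite Pd with n <ᵇ C | proof (n <? C)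
  ... | _ | ofʸ _   = refl
  ... | _ | ofⁿ n≮C = ⊥-elim (n≮C n<C)

  stepCost-evict : ∀ f n P d → P d ≡ false → ¬ n < C →
                   stepCost f n P d ≡ 1ℚ + f n (moveFront (move P (victim P d) d) d)
  stepCost-evict f n P d Pd n≮C rewrite Pd with n <ᵇ C | proof (n <? C)
  ... | _ | ofʸ n<C = ⊥-elim (n≮C n<C)
  ... | _ | ofⁿ _   = refl

  stepCost-cong : ∀ {f} → (∀ n {P Q} → P ≗ Q → f n P ≡ f n Q) → ∀ n {P Q} d → P ≗ Q → stepCost f n P d ≡ stepCost f n Q d
  stepCost-cong f-cong n {P} {Q} d P≗Q rewrite P≗Q d with Q d | n <ᵇ C
  ... | true  | _     = f-cong n (P≗Q ∘ before d)
  ... | false | true  = cong (1ℚ +_) (f-cong (suc n) (set-cong d true P≗Q ∘ before d))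
  ... | false | false rewrite firstMarked-cong d V 0 P≗Q =
    cong (1ℚ +_) (f-cong n (move-cong (victim Q d) d P≗Q ∘ before d))

  cost-cong : ∀ k n {P Q} → P ≗ Q → cost k n P ≡ cost k n Q
  cost-cong zero    n P≗Q = refl
  cost-cong (suc k) n P≗Q = sumFin-cong λ d → cong (s d *_) (stepCost-cong (cost-cong k) n (toℕ d) P≗Q)

  data InsertThenEvict (P : Occupancy) (y d : ℕ) : Set where
    evicts-inserted : moveFront (move (set P y true) (victim (set P y true) d) d) d ≗ moveFront (set P d true) d →
                      InsertThenEvict P y d
    evicts-above    : ∀ m → m < y → m ≢ d → P m ≡ true →
                      moveFront (move (set P y true) (victim (set P y true) d) d) d ≗
                        move (moveFront (set P d true) d) (after d m) (after d y) →
                      InsertThenEvict P y d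

  insertThenEvict : ∀ P {y d} → y < V → P y ≡ false → P d ≡ false → d ≢ y → InsertThenEvict P y d
  insertThenEvict P {y} {d} y<V Py Pd d≢y with victim (set P y true) d ≟ y
  ... | yes m≡y = evicts-inserted (moveFront-cong d λ j →
          trans (cong (λ z → move (set P y true) z d j) m≡y) (set-cong d true (set-set-id P true Py) j))
  ... | no  m≢y = evicts-above m (victim-< L d y<V (set-≡ P y true) m≢y) m≢d
                    (trans (sym (set-≢ P y true m≢y)) (victim-marked L d y<V (set-≡ P y true)))
                    (λ j → trans (moveFront-cong d (move-set-comm P m≢y m≢d d≢y) j) (moveFront-move (set P d true) d m y j))
    where
    L = set P y true
    m = victim L d
    m≢d = victim-≢ L d (trans (set-≢ P y true d≢y) Pd) y<V (set-≡ P y true)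

  evict-after-deeper : ∀ P p → suc p < V → P p ≡ true → P (suc p) ≡ false →
                       moveFront (move (move P p (suc p)) (victim (move P p (suc p)) p) p) p ≗
                         moveFront (move P (victim P (suc p)) (suc p)) (suc p)
  evict-after-deeper P p sp<V Pp Psp = by-cases (victim P (suc p) ≟ p)
    where
    open ≡-Reasoning
    Q = move P p (suc p)
    sp≢p = <⇒≢ (n<1+n p) ∘ sym
    p<V = <-trans (n<1+n p) sp<V
    first : FirstMarked P 0 p (victim P (suc p))
    first = victim-spec P (suc p) p<V Pp
    by-cases : Dec (victim P (suc p) ≡ p) →
               moveFront (move Q (victim Q p) p) p ≗ moveFront (move P (victim P (suc p)) (suc p)) (suc p)
    by-cases (yes m≡p) j = begin
      moveFront (move Q (victim Q p) p) p j
        ≡⟨ moveFront-cong p (λ i → trans (cong (λ z → move Q z p i) Qv≡sp)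
           (trans (move-move P p Psp sp≢p i) (set-set-id P false Pp i))) j ⟩
      moveFront P p j
        ≡⟨ moveFront-suc-move P p Pp Psp j ⟨
      moveFront (move P p (suc p)) (suc p) j
        ≡⟨ moveFront-cong (suc p) (λ i → cong (λ z → move P z (suc p) i) m≡p) j ⟨
      moveFront (move P (victim P (suc p)) (suc p)) (suc p) j ∎
      where
      Qv≡sp : victim Q p ≡ suc p
      Qv≡sp = victim-unique Q p sp<V (move-to P p (suc p)) none-before-sp
        where
        none-before-sp : ∀ {l} → l < suc p → Q l ≡ false
        none-before-sp {l} l<sp with l ≟ p
        ... | yes refl = move-from P (<⇒≢ (n<1+n p))
        ... | no  l≢p  = trans (move-other P l≢p (<⇒≢ l<sp))
                           (FirstMarked.none-before first z≤n (subst (l <_) (sym m≡p) (≤∧≢⇒< (≤-pred l<sp) l≢p)))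
    by-cases (no m≢p) j = begin
      moveFront (move Q (victim Q p) p) p j
        ≡⟨ moveFront-cong p (λ i → trans (cong (λ z → move Q z p i) Qv≡m) (move-move-back P Pp m≢p m≢sp sp≢p i)) j ⟩
      moveFront S′ p j
        ≡⟨ moveFront-suc-same S′ p (trans (move-to P m (suc p)) (sym S′p)) j ⟨
      moveFront S′ (suc p) j ∎
      where
      m = victim P (suc p)
      m<p = victim-< P (suc p) p<V Pp m≢p
      m≢sp = <⇒≢ (<-trans m<p (n<1+n p))
      S′ = move P m (suc p)
      S′p = trans (move-other P (m≢p ∘ sym) (sp≢p ∘ sym)) Pp
      Qv≡m : victim Q p ≡ m
      Qv≡m = victim-unique Q p (<-trans m<p p<V) (trans (move-other P m≢p m≢sp) (FirstMarked.first-marked first))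
               λ {l} l<m → trans (move-other P (<⇒≢ (<-trans l<m m<p)) (<⇒≢ (<-trans l<m (<-trans m<p (n<1+n p)))))
                             (FirstMarked.none-before first z≤n l<m)

  record Monotone (k : ℕ) : Set where
    field
      deeper-≤    : ∀ n {P} p → suc p < V → P p ≡ true → P (suc p) ≡ false →
                    cost k n (move P p (suc p)) ≤ℚ cost k n P
      insert-≤    : ∀ n {P} x → x < V → P x ≡ false → n < C → cost k (suc n) (set P x true) ≤ℚ cost k n P
      ≤-1+insert  : ∀ n {P} x → x < V → P x ≡ false → n < C → cost k n P ≤ℚ 1ℚ + cost k (suc n) (set P x true)
      ≤-1+replace : ∀ n {P} y x → y < V → x < V → P y ≡ true → P x ≡ false →
                    cost k n P ≤ℚ 1ℚ + cost k n (move P y x)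

  deeper*-≤ : ∀ {k} → Monotone k → ∀ n {P} i j → i < j → j < V → P i ≡ true → P j ≡ false →
              cost k n (move P i j) ≤ℚ cost k n P
  deeper*-≤ {k} H n {P} i (suc j) i<sj sj<V Pi Psj with i ≟ j
  ... | yes refl = Monotone.deeper-≤ H n i sj<V Pi Psj
  ... | no  i≢j  = via (mark? (P j))
    where
    open Monotone H
    open ≤-Reasoning
    i<j = ≤∧≢⇒< (≤-pred i<sj) i≢j
    j<V = <-trans (n<1+n j) sj<V
    via : Mark (P j) → cost k n (move P i (suc j)) ≤ℚ cost k n P
    via (unmarked Pj) = begin
      cost k n (move P i (suc j))
        ≡⟨ cost-cong k n (sym ∘ move-move P (suc j) Pj (i≢j ∘ sym)) ⟩
      cost k n (move (move P i j) j (suc j))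
        ≤⟨ deeper-≤ n j sj<V (move-to P i j) (trans (move-other P (>⇒≢ i<sj) 1+n≢n) Psj) ⟩
      cost k n (move P i j)
        ≤⟨ deeper*-≤ H n i j i<j j<V Pi Pj ⟩
      cost k n P ∎
    via (marked Pj) = begin
      cost k n (move P i (suc j))
        ≡⟨ cost-cong k n (sym ∘ move-move-back P Pj i≢j (<⇒≢ i<sj) 1+n≢n) ⟩
      cost k n (move (move P j (suc j)) i j)
        ≤⟨ deeper*-≤ H n i j i<j j<V (trans (move-other P i≢j (<⇒≢ i<sj)) Pi)
           (move-from P (<⇒≢ (n<1+n j))) ⟩
      cost k n (move P j (suc j))
        ≤⟨ deeper-≤ n j sj<V Pj Psj ⟩
      cost k n P ∎

  -- Evicting the victim instead of e leaves e buffered in place of a shallower item: a mark moved deeper.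
  evict-victim-≤ : ∀ {k} → Monotone k → ∀ n P {d e} → d < V → e < V → P d ≡ false → P e ≡ true →
                   cost k n (moveFront (move P (victim P d) d) d) ≤ℚ cost k n (moveFront (move P e d) d)
  evict-victim-≤ {k} H n P {d} {e} d<V e<V Pd Pe with victim P d ≟ e
  ... | yes m≡e = ≤-reflexive (cong (λ z → cost k n (moveFront (move P z d) d)) m≡e)
  ... | no  m≢e = begin
    cost k n (moveFront (move P m d) d)
      ≡⟨ cost-cong k n (λ j → trans (moveFront-cong d (move-via P Pe m≢e m≢d e≢d) j) (moveFront-move (move P e d) d m e j)) ⟩
    cost k n (move Y (after d m) (after d e))
      ≤⟨ deeper*-≤ H n _ _ (after-mono-< d (victim-< P d e<V Pe m≢e) m≢d e≢d) (after-bound d e d<V e<V) Ym Ye ⟩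
    cost k n Y ∎
    where
    open ≤-Reasoning
    m = victim P d
    m≢d = victim-≢ P d Pd e<V Pe
    e≢d : e ≢ d
    e≢d refl with () ← trans (sym Pd) Pe
    Y = moveFront (move P e d) d
    Ym : Y (after d m) ≡ true
    Ym = trans (moveFront-after (move P e d) d m) (trans (move-other P m≢e m≢d) (victim-marked P d e<V Pe))
    Ye : Y (after d e) ≡ false
    Ye = trans (moveFront-after (move P e d) d e) (move-from P e≢d)

  module Step {k} (H : Monotone k) where
    open Monotone H
    open ≤-Reasoning

    T : ℕ → Occupancy → ℕ → ℚ
    T = stepCost (cost k)

    T-hit : ∀ n P d → P d ≡ true → T n P d ≡ cost k n (moveFront P d)
    T-hit = stepCost-hit (cost k)

    T-insert : ∀ n P d → P d ≡ false → n < C → T n P d ≡ 1ℚ + cost k (suc n) (moveFront (set P d true) d)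
    T-insert = stepCost-insert (cost k)

    T-evict : ∀ n P d → P d ≡ false → ¬ n < C → T n P d ≡ 1ℚ + cost k n (moveFront (move P (victim P d) d) d)
    T-evict = stepCost-evict (cost k)

    insert-≤-step : ∀ n {P} y → y < V → P y ≡ false → n < C → ∀ d → d < V →
                    T (suc n) (set P y true) d ≤ℚ T n P d
    insert-≤-step n {P} y y<V Py n<C d d<V with d ≟ y | mark? (P d) | suc n <? C
    ... | yes refl | _ | _ = begin
      T (suc n) (set P d true) d
        ≡⟨ T-hit (suc n) (set P d true) d (set-≡ P d true) ⟩
      cost k (suc n) (moveFront (set P d true) d)
        ≤⟨ p≤1+q ≤-refl ⟩
      1ℚ + cost k (suc n) (moveFront (set P d true) d)
        ≡⟨ T-insert n P d Py n<C ⟨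
      T n P d ∎
    ... | no d≢y | marked Pd | _ = begin
      T (suc n) (set P y true) d
        ≡⟨ T-hit (suc n) (set P y true) d (trans (set-≢ P y true d≢y) Pd) ⟩
      cost k (suc n) (moveFront (set P y true) d)
        ≡⟨ cost-cong k (suc n) (moveFront-set P d y true) ⟩
      cost k (suc n) (set (moveFront P d) (after d y) true)
        ≤⟨ insert-≤ n (after d y) (after-bound d y d<V y<V) (trans (moveFront-after P d y) Py) n<C ⟩
      cost k n (moveFront P d)
        ≡⟨ T-hit n P d Pd ⟨
      T n P d ∎
    ... | no d≢y | unmarked Pd | yes sn<C = begin
      T (suc n) (set P y true) d
        ≡⟨ T-insert (suc n) (set P y true) d (trans (set-≢ P y true d≢y) Pd) sn<C ⟩
      1ℚ + cost k (suc (suc n)) (moveFront (set (set P y true) d true) d)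
        ≡⟨ cong (1ℚ +_) (cost-cong k _ λ j → trans (set-comm P true true (d≢y ∘ sym) (before d j))
           (moveFront-set (set P d true) d y true j)) ⟩
      1ℚ + cost k (suc (suc n)) (set P′ (after d y) true)
        ≤⟨ +-monoʳ-≤ 1ℚ (insert-≤ (suc n) (after d y) (after-bound d y d<V y<V) P′y sn<C) ⟩
      1ℚ + cost k (suc n) P′
        ≡⟨ T-insert n P d Pd n<C ⟨
      T n P d ∎
      where
      P′ = moveFront (set P d true) d
      P′y : P′ (after d y) ≡ false
      P′y = trans (moveFront-set-after P d true (d≢y ∘ sym)) Py
    ... | no d≢y | unmarked Pd | no sn≮C = begin
      T (suc n) L d
        ≡⟨ T-evict (suc n) L d (trans (set-≢ P y true d≢y) Pd) sn≮C ⟩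
      1ℚ + cost k (suc n) (moveFront (move L (victim L d) d) d)
        ≤⟨ +-monoʳ-≤ 1ℚ evict-≤ ⟩
      1ℚ + cost k (suc n) P′
        ≡⟨ T-insert n P d Pd n<C ⟨
      T n P d ∎
      where
      L = set P y true
      P′ = moveFront (set P d true) d
      evict-≤ : cost k (suc n) (moveFront (move L (victim L d) d) d) ≤ℚ cost k (suc n) P′
      evict-≤ with insertThenEvict P y<V Py Pd d≢y
      ... | evicts-inserted eq = ≤-reflexive (cost-cong k (suc n) eq)
      ... | evicts-above m m<y m≢d Pm eq = begin
        cost k (suc n) (moveFront (move L (victim L d) d) d)
          ≡⟨ cost-cong k (suc n) eq ⟩
        cost k (suc n) (move P′ (after d m) (after d y))
          ≤⟨ deeper*-≤ H (suc n) _ _ (after-mono-< d m<y m≢d (d≢y ∘ sym)) (after-bound d y d<V y<V) P′m P′y ⟩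
        cost k (suc n) P′ ∎
        where
        P′m : P′ (after d m) ≡ true
        P′m = trans (moveFront-set-after P d true m≢d) Pm
        P′y : P′ (after d y) ≡ false
        P′y = trans (moveFront-set-after P d true (d≢y ∘ sym)) Py

    ≤-1+insert-step : ∀ n {P} x → x < V → P x ≡ false → n < C → ∀ d → d < V →
                      T n P d ≤ℚ 1ℚ + T (suc n) (set P x true) d
    ≤-1+insert-step n {P} x x<V Px n<C d d<V with d ≟ x | mark? (P d) | suc n <? C
    ... | yes refl | _ | _ = ≤-reflexive (begin-equality
      T n P d
        ≡⟨ T-insert n P d Px n<C ⟩
      1ℚ + cost k (suc n) (moveFront (set P d true) d)
        ≡⟨ cong (1ℚ +_) (T-hit (suc n) (set P d true) d (set-≡ P d true)) ⟨
      1ℚ + T (suc n) (set P d true) d ∎)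
    ... | no d≢x | marked Pd | _ = begin
      T n P d
        ≡⟨ T-hit n P d Pd ⟩
      cost k n (moveFront P d)
        ≤⟨ ≤-1+insert n (after d x) (after-bound d x d<V x<V) (trans (moveFront-after P d x) Px) n<C ⟩
      1ℚ + cost k (suc n) (set (moveFront P d) (after d x) true)
        ≡⟨ cong (1ℚ +_) (cost-cong k (suc n) (moveFront-set P d x true)) ⟨
      1ℚ + cost k (suc n) (moveFront (set P x true) d)
        ≡⟨ cong (1ℚ +_) (T-hit (suc n) (set P x true) d (trans (set-≢ P x true d≢x) Pd)) ⟨
      1ℚ + T (suc n) (set P x true) d ∎
    ... | no d≢x | unmarked Pd | yes sn<C = begin
      T n P d
        ≡⟨ T-insert n P d Pd n<C ⟩
      1ℚ + cost k (suc n) P′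
        ≤⟨ +-monoʳ-≤ 1ℚ (≤-1+insert (suc n) (after d x) (after-bound d x d<V x<V) P′x sn<C) ⟩
      1ℚ + (1ℚ + cost k (suc (suc n)) (set P′ (after d x) true))
        ≡⟨ cong (λ c → 1ℚ + (1ℚ + c)) (cost-cong k _ λ j → trans (moveFront-cong d (set-comm P true true (d≢x ∘ sym)) j)
           (moveFront-set (set P d true) d x true j)) ⟨
      1ℚ + (1ℚ + cost k (suc (suc n)) (moveFront (set (set P x true) d true) d))
        ≡⟨ cong (1ℚ +_) (T-insert (suc n) (set P x true) d (trans (set-≢ P x true d≢x) Pd) sn<C) ⟨
      1ℚ + T (suc n) (set P x true) d ∎
      where
      P′ = moveFront (set P d true) d
      P′x : P′ (after d x) ≡ false
      P′x = trans (moveFront-set-after P d true (d≢x ∘ sym)) Px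
    ... | no d≢x | unmarked Pd | no sn≮C = begin
      T n P d
        ≡⟨ T-insert n P d Pd n<C ⟩
      1ℚ + cost k (suc n) P′
        ≤⟨ +-monoʳ-≤ 1ℚ evict-≤ ⟩
      1ℚ + (1ℚ + cost k (suc n) (moveFront (move B (victim B d) d) d))
        ≡⟨ cong (1ℚ +_) (T-evict (suc n) B d (trans (set-≢ P x true d≢x) Pd) sn≮C) ⟨
      1ℚ + T (suc n) B d ∎
      where
      B = set P x true
      P′ = moveFront (set P d true) d
      evict-≤ : cost k (suc n) P′ ≤ℚ 1ℚ + cost k (suc n) (moveFront (move B (victim B d) d) d)
      evict-≤ with insertThenEvict P x<V Px Pd d≢x
      ... | evicts-inserted eq = p≤1+q (≤-reflexive (cost-cong k (suc n) (sym ∘ eq)))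
      ... | evicts-above m m<x m≢d Pm eq = begin
        cost k (suc n) P′
          ≤⟨ ≤-1+replace (suc n) (after d m) (after d x) (after-bound d m d<V (<-trans m<x x<V)) (after-bound d x d<V x<V)
             (trans (moveFront-set-after P d true m≢d) Pm) (trans (moveFront-set-after P d true (d≢x ∘ sym)) Px) ⟩
        1ℚ + cost k (suc n) (move P′ (after d m) (after d x))
          ≡⟨ cong (1ℚ +_) (cost-cong k (suc n) eq) ⟨
        1ℚ + cost k (suc n) (moveFront (move B (victim B d) d) d) ∎

    ≤-1+replace-at-to : ∀ n {P} y x → y < V → x < V → P y ≡ true → P x ≡ false →
                        T n P x ≤ℚ 1ℚ + T n (move P y x) x
    ≤-1+replace-at-to n {P} y x y<V x<V Py Px = begin
      T n P x
        ≤⟨ access-≤ ⟩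
      1ℚ + cost k n (moveFront B x)
        ≡⟨ cong (1ℚ +_) (T-hit n B x (move-to P y x)) ⟨
      1ℚ + T n B x ∎
      where
      B = move P y x
      access-≤ : T n P x ≤ℚ 1ℚ + cost k n (moveFront B x)
      access-≤ with n <? C
      ... | yes n<C = begin
        T n P x
          ≡⟨ T-insert n P x Px n<C ⟩
        1ℚ + cost k (suc n) (moveFront (set P x true) x)
          ≡⟨ cong (1ℚ +_) (cost-cong k (suc n) λ j →
             trans (moveFront-cong x (λ i → sym (set-move P x Py (marked≢unmarked P Py Px ∘ sym) i)) j)
                 (moveFront-set B x y true j)) ⟩
        1ℚ + cost k (suc n) (set (moveFront B x) (after x y) true)
          ≤⟨ +-monoʳ-≤ 1ℚ (insert-≤ n (after x y) (after-bound x y x<V y<V)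
             (trans (moveFront-after B x y) (move-from P (marked≢unmarked P Py Px))) n<C) ⟩
        1ℚ + cost k n (moveFront B x) ∎
      ... | no n≮C = begin
        T n P x
          ≡⟨ T-evict n P x Px n≮C ⟩
        1ℚ + cost k n (moveFront (move P (victim P x) x) x)
          ≤⟨ +-monoʳ-≤ 1ℚ (evict-victim-≤ H n P x<V y<V Px Py) ⟩
        1ℚ + cost k n (moveFront B x) ∎

    ≤-1+replace-at-from : ∀ n {P} y x → y < V → x < V → P y ≡ true → P x ≡ false →
                          T n P y ≤ℚ 1ℚ + T n (move P y x) y
    ≤-1+replace-at-from n {P} y x y<V x<V Py Px = p≤1+q (begin
      T n P y
        ≡⟨ T-hit n P y Py ⟩
      cost k n (moveFront P y)
        ≤⟨ access-≤ ⟩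
      T n B y ∎)
      where
      B = move P y x
      y≢x = marked≢unmarked P Py Px
      By = move-from P y≢x
      access-≤ : cost k n (moveFront P y) ≤ℚ T n B y
      access-≤ with n <? C
      ... | yes n<C = begin
        cost k n (moveFront P y)
          ≤⟨ ≤-1+insert n (after y x) (after-bound y x y<V x<V) (trans (moveFront-after P y x) Px) n<C ⟩
        1ℚ + cost k (suc n) (set (moveFront P y) (after y x) true)
          ≡⟨ cong (1ℚ +_) (cost-cong k (suc n) λ j →
             trans (moveFront-cong y (set-move P x Py (y≢x ∘ sym)) j) (moveFront-set P y x true j)) ⟨
        1ℚ + cost k (suc n) (moveFront (set B y true) y)
          ≡⟨ T-insert n B y By n<C ⟨
        T n B y ∎
      ... | no n≮C with insertThenEvict (set P y false) x<V (trans (set-≢ P y false (y≢x ∘ sym)) Px) (set-≡ P y false) y≢x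
      ...   | evicts-inserted eq = begin
        cost k n (moveFront P y)
          ≡⟨ cost-cong k n (λ j → trans (moveFront-cong y (λ i → sym (set-set-id P false Py i)) j) (sym (eq j))) ⟩
        cost k n (moveFront (move B (victim B y) y) y)
          ≤⟨ p≤1+q ≤-refl ⟩
        1ℚ + cost k n (moveFront (move B (victim B y) y) y)
          ≡⟨ T-evict n B y By n≮C ⟨
        T n B y ∎
      ...   | evicts-above m m<x m≢y P₀m eq = begin
        cost k n (moveFront P y)
          ≤⟨ ≤-1+replace n (after y m) (after y x) (after-bound y m y<V (<-trans m<x x<V)) (after-bound y x y<V x<V)
             (trans (moveFront-after P y m) Pm) (trans (moveFront-after P y x) Px) ⟩
        1ℚ + cost k n (move (moveFront P y) (after y m) (after y x))
          ≡⟨ cong (1ℚ +_) (cost-cong k n λ j →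
             trans (eq j) (move-cong (after y m) (after y x) (moveFront-cong y (set-set-id P false Py)) j)) ⟨
        1ℚ + cost k n (moveFront (move B (victim B y) y) y)
          ≡⟨ T-evict n B y By n≮C ⟨
        T n B y ∎
        where
        Pm : P m ≡ true
        Pm = trans (sym (set-≢ P y false m≢y)) P₀m

    replace-evict-≤ : ∀ n {P} y x → y < V → x < V → P y ≡ true → P x ≡ false →
                      ∀ d → d < V → d ≢ y → d ≢ x → P d ≡ false →
                      cost k n (moveFront (move P (victim P d) d) d) ≤ℚ
                        1ℚ + cost k n (moveFront (move (move P y x) (victim (move P y x) d) d) d)
    replace-evict-≤ n {P} y x y<V x<V Py Px d d<V d≢y d≢x Pd = by-cases (victim (move P y x) d ≟ x)
      where
      B = move P y x
      by-cases : Dec (victim B d ≡ x) →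
                 cost k n (moveFront (move P (victim P d) d) d) ≤ℚ 1ℚ + cost k n (moveFront (move B (victim B d) d) d)
      by-cases (yes mB≡x) = p≤1+q (begin
        cost k n (moveFront (move P (victim P d) d) d)
          ≤⟨ evict-victim-≤ H n P d<V y<V Pd Py ⟩
        cost k n (moveFront (move P y d) d)
          ≡⟨ cost-cong k n (moveFront-cong d λ j →
             trans (cong (λ z → move B z d j) mB≡x) (move-move P d Px (marked≢unmarked P Py Px ∘ sym) j)) ⟨
        cost k n (moveFront (move B (victim B d) d) d) ∎)
      by-cases (no mB≢x) = begin
        cost k n (moveFront (move P (victim P d) d) d)
          ≤⟨ evict-victim-≤ H n P d<V (victim-bound B d x<V (move-to P y x)) Pd Pm ⟩
        cost k n Z
          ≤⟨ ≤-1+replace n (after d y) (after d x) (after-bound d y d<V y<V) (after-bound d x d<V x<V)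
             (trans (moveFront-after (move P m d) d y) (trans (move-other P (m≢y ∘ sym) (d≢y ∘ sym)) Py))
             (trans (moveFront-after (move P m d) d x) (trans (move-other P (mB≢x ∘ sym) (d≢x ∘ sym)) Px)) ⟩
        1ℚ + cost k n (move Z (after d y) (after d x))
          ≡⟨ cong (1ℚ +_) (cost-cong k n λ j →
             trans (moveFront-cong d (move-move-comm P m≢y mB≢x d≢y d≢x) j) (moveFront-move (move P m d) d y x j)) ⟨
        1ℚ + cost k n (moveFront (move B m d) d) ∎
        where
        m = victim B d
        Bm : B m ≡ true
        Bm = victim-marked B d x<V (move-to P y x)
        m≢y : m ≢ y
        m≢y m≡y = marked≢unmarked B Bm (move-from P (marked≢unmarked P Py Px)) m≡y
        Pm : P m ≡ true
        Pm = trans (sym (move-other P m≢y mB≢x)) Bm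
        Z = moveFront (move P m d) d

    ≤-1+replace-elsewhere : ∀ n {P} y x → y < V → x < V → P y ≡ true → P x ≡ false → ∀ d → d < V → d ≢ y → d ≢ x →
                            T n P d ≤ℚ 1ℚ + T n (move P y x) d
    ≤-1+replace-elsewhere n {P} y x y<V x<V Py Px d d<V d≢y d≢x with mark? (P d) | n <? C
    ... | marked Pd | _ = begin
      T n P d
        ≡⟨ T-hit n P d Pd ⟩
      cost k n (moveFront P d)
        ≤⟨ ≤-1+replace n (after d y) (after d x) (after-bound d y d<V y<V) (after-bound d x d<V x<V)
           (trans (moveFront-after P d y) Py) (trans (moveFront-after P d x) Px) ⟩
      1ℚ + cost k n (move (moveFront P d) (after d y) (after d x))
        ≡⟨ cong (1ℚ +_) (cost-cong k n (moveFront-move P d y x)) ⟨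
      1ℚ + cost k n (moveFront B d)
        ≡⟨ cong (1ℚ +_) (T-hit n B d (trans (move-other P d≢y d≢x) Pd)) ⟨
      1ℚ + T n B d ∎
      where B = move P y x
    ... | unmarked Pd | yes n<C = begin
      T n P d
        ≡⟨ T-insert n P d Pd n<C ⟩
      1ℚ + cost k (suc n) P′
        ≤⟨ +-monoʳ-≤ 1ℚ (≤-1+replace (suc n) (after d y) (after d x) (after-bound d y d<V y<V) (after-bound d x d<V x<V)
           (trans (moveFront-set-after P d true (d≢y ∘ sym)) Py) (trans (moveFront-set-after P d true (d≢x ∘ sym)) Px)) ⟩
      1ℚ + (1ℚ + cost k (suc n) (move P′ (after d y) (after d x)))
        ≡⟨ cong (λ c → 1ℚ + (1ℚ + c)) (cost-cong k (suc n) λ j →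
           trans (moveFront-cong d (set-move-comm P true d≢y d≢x) j) (moveFront-move (set P d true) d y x j)) ⟨
      1ℚ + (1ℚ + cost k (suc n) (moveFront (set B d true) d))
        ≡⟨ cong (1ℚ +_) (T-insert n B d (trans (move-other P d≢y d≢x) Pd) n<C) ⟨
      1ℚ + T n B d ∎
      where
      B = move P y x
      P′ = moveFront (set P d true) d
    ... | unmarked Pd | no n≮C = begin
      T n P d
        ≡⟨ T-evict n P d Pd n≮C ⟩
      1ℚ + cost k n (moveFront (move P (victim P d) d) d)
        ≤⟨ +-monoʳ-≤ 1ℚ (replace-evict-≤ n y x y<V x<V Py Px d d<V d≢y d≢x Pd) ⟩
      1ℚ + (1ℚ + cost k n (moveFront (move B (victim B d) d) d))
        ≡⟨ cong (1ℚ +_) (T-evict n B d Bd n≮C) ⟨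
      1ℚ + T n B d ∎
      where
      B = move P y x
      Bd = trans (move-other P d≢y d≢x) Pd

    ≤-1+replace-step : ∀ n {P} y x → y < V → x < V → P y ≡ true → P x ≡ false → ∀ d → d < V →
                       T n P d ≤ℚ 1ℚ + T n (move P y x) d
    ≤-1+replace-step n y x y<V x<V Py Px d d<V with d ≟ x | d ≟ y
    ... | yes refl | _        = ≤-1+replace-at-to n y d y<V x<V Py Px
    ... | no  _    | yes refl = ≤-1+replace-at-from n d x y<V x<V Py Px
    ... | no  d≢x  | no  d≢y  = ≤-1+replace-elsewhere n y x y<V x<V Py Px d d<V d≢y d≢x

    deeper-evict-≤ : ∀ n {P} p → suc p < V → P p ≡ true → P (suc p) ≡ false →
                     ∀ d → d < V → d ≢ p → d ≢ suc p → P d ≡ false →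
                     cost k n (moveFront (move (move P p (suc p)) (victim (move P p (suc p)) d) d) d) ≤ℚ
                       cost k n (moveFront (move P (victim P d) d) d)
    deeper-evict-≤ n {P} p sp<V Pp Psp d d<V d≢p d≢sp Pd = by-cases (victim P d ≟ p)
      where
      Q = move P p (suc p)
      Qd = trans (move-other P d≢p d≢sp) Pd
      p≢d = d≢p ∘ sym
      sp≢d = d≢sp ∘ sym
      p<V = <-trans (n<1+n p) sp<V
      p′ = after d p
      sp′<V = subst (_< V) (after-suc d p≢d sp≢d) (after-bound d (suc p) d<V sp<V)
      by-cases : Dec (victim P d ≡ p) →
                 cost k n (moveFront (move Q (victim Q d) d) d) ≤ℚ cost k n (moveFront (move P (victim P d) d) d)
      by-cases (yes mP≡p) = begin
        cost k n (moveFront (move Q (victim Q d) d) d)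
          ≤⟨ evict-victim-≤ H n Q d<V sp<V Qd (move-to P p (suc p)) ⟩
        cost k n (moveFront (move Q (suc p) d) d)
          ≡⟨ cost-cong k n (moveFront-cong d λ j →
             trans (move-move P d Psp (<⇒≢ (n<1+n p) ∘ sym) j) (cong (λ z → move P z d j) (sym mP≡p))) ⟩
        cost k n (moveFront (move P (victim P d) d) d) ∎
      by-cases (no mP≢p) = begin
        cost k n (moveFront (move Q (victim Q d) d) d)
          ≤⟨ evict-victim-≤ H n Q d<V (victim-bound P d p<V Pp) Qd Qm ⟩
        cost k n (moveFront (move Q m d) d)
          ≡⟨ cost-cong k n (λ j → trans (moveFront-cong d (move-move-comm P mP≢p m≢sp d≢p d≢sp) j)
             (moveFront-move-adjacent (move P m d) p≢d sp≢d j)) ⟩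
        cost k n (move X p′ (suc p′))
          ≤⟨ deeper-≤ n p′ sp′<V
             (trans (moveFront-after (move P m d) d p) (trans (move-other P (mP≢p ∘ sym) (d≢p ∘ sym)) Pp))
             (trans (moveFront-after-suc (move P m d) p≢d sp≢d) (trans (move-other P (m≢sp ∘ sym) sp≢d) Psp)) ⟩
        cost k n X ∎
        where
        m = victim P d
        m≢sp : m ≢ suc p
        m≢sp m≡sp = <-irrefl m≡sp (≤-<-trans (victim-≤ P d p<V Pp) (n<1+n p))
        Qm : Q m ≡ true
        Qm = trans (move-other P mP≢p m≢sp) (victim-marked P d p<V Pp)
        X = moveFront (move P m d) d

    deeper-elsewhere : ∀ n {P} p → suc p < V → P p ≡ true → P (suc p) ≡ false → ∀ d → d < V → d ≢ p → d ≢ suc p →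
                       T n (move P p (suc p)) d ≤ℚ T n P d
    deeper-elsewhere n {P} p sp<V Pp Psp d d<V d≢p d≢sp = by-cases (mark? (P d)) (n <? C)
      where
      Q = move P p (suc p)
      p≢d = d≢p ∘ sym
      sp≢d = d≢sp ∘ sym
      p<V = <-trans (n<1+n p) sp<V
      p′ = after d p
      sp′<V = subst (_< V) (after-suc d p≢d sp≢d) (after-bound d (suc p) d<V sp<V)
      by-cases : Mark (P d) → Dec (n < C) → T n Q d ≤ℚ T n P d
      by-cases (marked Pd) _ = begin
        T n Q d
          ≡⟨ T-hit n Q d (trans (move-other P d≢p d≢sp) Pd) ⟩
        cost k n (moveFront Q d)
          ≡⟨ cost-cong k n (moveFront-move-adjacent P p≢d sp≢d) ⟩
        cost k n (move (moveFront P d) p′ (suc p′))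
          ≤⟨ deeper-≤ n p′ sp′<V (trans (moveFront-after P d p) Pp) (trans (moveFront-after-suc P p≢d sp≢d) Psp) ⟩
        cost k n (moveFront P d)
          ≡⟨ T-hit n P d Pd ⟨
        T n P d ∎
      by-cases (unmarked Pd) (yes n<C) = begin
        T n Q d
          ≡⟨ T-insert n Q d (trans (move-other P d≢p d≢sp) Pd) n<C ⟩
        1ℚ + cost k (suc n) (moveFront (set Q d true) d)
          ≡⟨ cong (1ℚ +_) (cost-cong k (suc n) λ j →
             trans (moveFront-cong d (set-move-comm P true d≢p d≢sp) j)
                 (moveFront-move-adjacent (set P d true) p≢d sp≢d j)) ⟩
        1ℚ + cost k (suc n) (move P′ p′ (suc p′))
          ≤⟨ +-monoʳ-≤ 1ℚ (deeper-≤ (suc n) p′ sp′<V (trans (moveFront-set-after P d true p≢d) Pp)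
             (trans (moveFront-after-suc (set P d true) p≢d sp≢d) (trans (set-≢ P d true sp≢d) Psp))) ⟩
        1ℚ + cost k (suc n) P′
          ≡⟨ T-insert n P d Pd n<C ⟨
        T n P d ∎
        where P′ = moveFront (set P d true) d
      by-cases (unmarked Pd) (no n≮C) = begin
        T n Q d
          ≡⟨ T-evict n Q d Qd n≮C ⟩
        1ℚ + cost k n (moveFront (move Q (victim Q d) d) d)
          ≤⟨ +-monoʳ-≤ 1ℚ (deeper-evict-≤ n p sp<V Pp Psp d d<V d≢p d≢sp Pd) ⟩
        1ℚ + cost k n (moveFront (move P (victim P d) d) d)
          ≡⟨ T-evict n P d Pd n≮C ⟨
        T n P d ∎
        where
        Qd = trans (move-other P d≢p d≢sp) Pd

    deeper-at-suc : ∀ n {P} p → P p ≡ true → P (suc p) ≡ false → T n (move P p (suc p)) (suc p) ≡ T n P p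
    deeper-at-suc n {P} p Pp Psp = begin-equality
      T n (move P p (suc p)) (suc p)
        ≡⟨ T-hit n (move P p (suc p)) (suc p) (move-to P p (suc p)) ⟩
      cost k n (moveFront (move P p (suc p)) (suc p))
        ≡⟨ cost-cong k n (moveFront-suc-move P p Pp Psp) ⟩
      cost k n (moveFront P p)
        ≡⟨ T-hit n P p Pp ⟨
      T n P p ∎

    deeper-at : ∀ n {P} p → suc p < V → P p ≡ true → P (suc p) ≡ false → T n (move P p (suc p)) p ≡ T n P (suc p)
    deeper-at n {P} p sp<V Pp Psp = by-cases (n <? C)
      where
      Q = move P p (suc p)
      sp≢p = <⇒≢ (n<1+n p) ∘ sym
      Qp = move-from P (<⇒≢ (n<1+n p))
      by-cases : Dec (n < C) → T n Q p ≡ T n P (suc p)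
      by-cases (yes n<C) = begin-equality
        T n Q p
          ≡⟨ T-insert n Q p Qp n<C ⟩
        1ℚ + cost k (suc n) (moveFront (set Q p true) p)
          ≡⟨ cong (1ℚ +_) (cost-cong k (suc n) λ j →
             trans (moveFront-cong p (set-move P (suc p) Pp sp≢p) j)
                 (sym (moveFront-suc-same S p (trans (set-≡ P (suc p) true) (sym Sp)) j))) ⟩
        1ℚ + cost k (suc n) (moveFront S (suc p))
          ≡⟨ T-insert n P (suc p) Psp n<C ⟨
        T n P (suc p) ∎
        where
        S = set P (suc p) true
        Sp = trans (set-≢ P (suc p) true (sp≢p ∘ sym)) Pp
      by-cases (no n≮C) = begin-equality
        T n Q p
          ≡⟨ T-evict n Q p Qp n≮C ⟩
        1ℚ + cost k n (moveFront (move Q (victim Q p) p) p)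
          ≡⟨ cong (1ℚ +_) (cost-cong k n (evict-after-deeper P p sp<V Pp Psp)) ⟩
        1ℚ + cost k n (moveFront (move P (victim P (suc p)) (suc p)) (suc p))
          ≡⟨ T-evict n P (suc p) Psp n≮C ⟨
        T n P (suc p) ∎

    access-≤-access-suc : ∀ n {P} p → suc p < V → P p ≡ true → P (suc p) ≡ false → T n P p ≤ℚ T n P (suc p)
    access-≤-access-suc n {P} p sp<V Pp Psp = begin
      T n P p
        ≡⟨ T-hit n P p Pp ⟩
      cost k n (moveFront P p)
        ≤⟨ by-cases (n <? C) ⟩
      T n P (suc p) ∎
      where
      sp≢p = <⇒≢ (n<1+n p) ∘ sym
      p<V = <-trans (n<1+n p) sp<V
      sp′<V = subst (_< V) (sym (after-> (n<1+n p))) sp<V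
      by-cases : Dec (n < C) → cost k n (moveFront P p) ≤ℚ T n P (suc p)
      by-cases (yes n<C) = begin
        cost k n (moveFront P p)
          ≤⟨ ≤-1+insert n (after p (suc p)) sp′<V (trans (moveFront-after P p (suc p)) Psp) n<C ⟩
        1ℚ + cost k (suc n) (set (moveFront P p) (after p (suc p)) true)
          ≡⟨ cong (1ℚ +_) (cost-cong k (suc n) λ j →
             trans (moveFront-suc-same S p (trans (set-≡ P (suc p) true) (sym Sp)) j) (moveFront-set P p (suc p) true j)) ⟨
        1ℚ + cost k (suc n) (moveFront S (suc p))
          ≡⟨ T-insert n P (suc p) Psp n<C ⟨
        T n P (suc p) ∎
        where
        S = set P (suc p) true
        Sp = trans (set-≢ P (suc p) true (sp≢p ∘ sym)) Pp
      by-cases (no n≮C) with victim P (suc p) ≟ p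
      ... | yes m≡p = begin
        cost k n (moveFront P p)
          ≤⟨ p≤1+q ≤-refl ⟩
        1ℚ + cost k n (moveFront P p)
          ≡⟨ cong (1ℚ +_) (cost-cong k n λ j →
             trans (moveFront-cong (suc p) (λ i → cong (λ z → move P z (suc p) i) m≡p) j)
                 (moveFront-suc-move P p Pp Psp j)) ⟨
        1ℚ + cost k n (moveFront (move P (victim P (suc p)) (suc p)) (suc p))
          ≡⟨ T-evict n P (suc p) Psp n≮C ⟨
        T n P (suc p) ∎
      ... | no m≢p = begin
        cost k n (moveFront P p)
          ≤⟨ ≤-1+replace n (after p m) (after p (suc p)) (after-bound p m p<V (<-trans m<p p<V)) sp′<V
             (trans (moveFront-after P p m) (victim-marked P (suc p) p<V Pp)) (trans (moveFront-after P p (suc p)) Psp) ⟩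
        1ℚ + cost k n (move (moveFront P p) (after p m) (after p (suc p)))
          ≡⟨ cong (1ℚ +_) (cost-cong k n λ j →
             trans (moveFront-suc-same S′ p (trans (move-to P m (suc p)) (sym S′p)) j) (moveFront-move P p m (suc p) j)) ⟨
        1ℚ + cost k n (moveFront S′ (suc p))
          ≡⟨ T-evict n P (suc p) Psp n≮C ⟨
        T n P (suc p) ∎
        where
        m = victim P (suc p)
        m<p = victim-< P (suc p) p<V Pp m≢p
        S′ = move P m (suc p)
        S′p = trans (move-other P (m≢p ∘ sym) (sp≢p ∘ sym)) Pp

  module Induction (s-dist : IsDistribution s) (s-mono : NonDecreasing s) where

    monotone-suc : ∀ {k} → Monotone k → Monotone (suc k)
    monotone-suc {k} H = record
      { deeper-≤    = deeper-≤′
      ; insert-≤    = λ n x x<V Px n<C → expectation-mono-≤ (proj₁ s-dist) (at-depth (insert-≤-step n x x<V Px n<C))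
      ; ≤-1+insert  = λ n x x<V Px n<C → expectation-≤-1+ s-dist (at-depth (≤-1+insert-step n x x<V Px n<C))
      ; ≤-1+replace = λ n y x y<V x<V Py Px → expectation-≤-1+ s-dist (at-depth (≤-1+replace-step n y x y<V x<V Py Px))
      }
      where
      open Step H
      at-depth : ∀ {f g : ℕ → ℚ} → (∀ d → d < V → f d ≤ℚ g d) → ∀ (d : Fin V) → f (toℕ d) ≤ℚ g (toℕ d)
      at-depth f≤g d = f≤g (toℕ d) (toℕ<n d)
      deeper-≤′ : ∀ n {P} p → suc p < V → P p ≡ true → P (suc p) ≡ false →
                  cost (suc k) n (move P p (suc p)) ≤ℚ cost (suc k) n P
      deeper-≤′ n {P} p sp<V Pp Psp = sumFin-mono-except₂ p̂ sp̂ p̂≢sp̂ elsewhere at-p-and-suc-p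
        where
        Q = move P p (suc p)
        p̂ = fromℕ< (<-trans (n<1+n p) sp<V)
        sp̂ = fromℕ< sp<V
        p̂≡p : toℕ p̂ ≡ p
        p̂≡p = toℕ-fromℕ< (<-trans (n<1+n p) sp<V)
        sp̂≡sp : toℕ sp̂ ≡ suc p
        sp̂≡sp = toℕ-fromℕ< sp<V
        p̂≢sp̂ : p̂ ≢ sp̂
        p̂≢sp̂ eq = <⇒≢ (n<1+n p) (trans (sym p̂≡p) (trans (cong toℕ eq) sp̂≡sp))
        elsewhere : ∀ d → d ≢ p̂ → d ≢ sp̂ → s d * T n Q (toℕ d) ≤ℚ s d * T n P (toℕ d)
        elsewhere d d≢p d≢sp = *-monoˡ-≤-nonNeg′ (s d) (proj₁ s-dist d)
          (deeper-elsewhere n {P} p sp<V Pp Psp (toℕ d) (toℕ<n d)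
            (λ e → d≢p (toℕ-injective (trans e (sym p̂≡p)))) (λ e → d≢sp (toℕ-injective (trans e (sym sp̂≡sp)))))
        -- In Q the accesses of depths p and p + 1 swap their costs in P; as s p ≤ s (p + 1) and the
        -- access of p + 1 is the costlier one in P, the swap cannot increase the expectation.
        at-p-and-suc-p : s p̂ * T n Q (toℕ p̂) + s sp̂ * T n Q (toℕ sp̂) ≤ℚ s p̂ * T n P (toℕ p̂) + s sp̂ * T n P (toℕ sp̂)
        at-p-and-suc-p rewrite p̂≡p | sp̂≡sp | deeper-at n {P} p sp<V Pp Psp | deeper-at-suc n {P} p Pp Psp =
          rearrangement (s p̂) (s sp̂) _ _ (s-mono p̂ sp̂ (trans sp̂≡sp (cong suc (sym p̂≡p))))
              (access-≤-access-suc n {P} p sp<V Pp Psp)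

    monotone : ∀ k → Monotone k
    monotone zero    = record
      { deeper-≤ = λ _ _ _ _ _ → ≤-refl ; insert-≤ = λ _ _ _ _ _ → ≤-refl
      ; ≤-1+insert = λ _ _ _ _ _ → p≤1+q ≤-refl ; ≤-1+replace = λ _ _ _ _ _ _ _ → p≤1+q ≤-refl }
    monotone (suc k) = monotone-suc (monotone k)

-- Stacks and buffers

moveToFront-< : ∀ {V} (σ : Stack (suc V)) d {j} → toℕ j < toℕ d → moveToFront σ d (suc j) ≡ σ (inject₁ j)
moveToFront-< σ d {j} j<d with toℕ j <ᵇ toℕ d | proof (toℕ j <? toℕ d)
... | _ | ofʸ _   = refl
... | _ | ofⁿ j≮d = contradiction j<d j≮d

moveToFront-≮ : ∀ {V} (σ : Stack (suc V)) d {j} → ¬ toℕ j < toℕ d → moveToFront σ d (suc j) ≡ σ (suc j)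
moveToFront-≮ σ d {j} j≮d with toℕ j <ᵇ toℕ d | proof (toℕ j <? toℕ d)
... | _ | ofʸ j<d = contradiction j<d j≮d
... | _ | ofⁿ _   = refl

moveToFront-before : ∀ {V} (σ : Stack V) d i → ∃ λ i′ → moveToFront σ d i ≡ σ i′ × toℕ i′ ≡ before (toℕ d) (toℕ i)
moveToFront-before {suc V} σ d zero    = d , refl , refl
moveToFront-before {suc V} σ d (suc j) with toℕ j <? toℕ d
... | yes j<d = inject₁ j , moveToFront-< σ d j<d , toℕ-inject₁ j
... | no  j≮d = suc j , moveToFront-≮ σ d j≮d , refl

moveToFront-injective : ∀ {V} (σ : Stack V) d → Injective _≡_ _≡_ σ → Injective _≡_ _≡_ (moveToFront σ d)
moveToFront-injective σ d σ-inj {i} {j} eq with moveToFront-before σ d i | moveToFront-before σ d j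
... | i′ , σi≡ , i′≡ | j′ , σj≡ , j′≡ = toℕ-injective (before-injective (toℕ d)
  (trans (sym i′≡) (trans (cong toℕ (σ-inj (trans (sym σi≡) (trans eq σj≡)))) j′≡)))

injective⇒surjective : ∀ {n} (f : Fin n → Fin n) → Injective _≡_ _≡_ f → ∀ y → ∃ λ x → f x ≡ y
injective⇒surjective {suc m} f f-inj y with any? (λ x → f x ≟ᶠ y)
... | yes hit = hit
... | no  miss with pigeonhole (n<1+n m) (λ x → punchOut {i = y} (λ e → miss (x , sym e)))
...   | i , j , i<j , eq = contradiction (cong toℕ
    (f-inj (punchOut-injective (λ e → miss (i , sym e)) (λ e → miss (j , sym e)) eq))) (<⇒≢ i<j)

∣set-true∣ : ∀ {n} (B : Buffer n) i → lookup B i ≡ false → ∣ B [ i ]≔ true ∣ ≡ suc ∣ B ∣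
∣set-true∣ (false ∷ B) zero    refl = refl
∣set-true∣ (true  ∷ B) (suc i) Bi   = cong suc (∣set-true∣ B i Bi)
∣set-true∣ (false ∷ B) (suc i) Bi   = ∣set-true∣ B i Bi

∣set-false∣ : ∀ {n} (B : Buffer n) i → lookup B i ≡ true → suc ∣ B [ i ]≔ false ∣ ≡ ∣ B ∣
∣set-false∣ (true  ∷ B) zero    refl = refl
∣set-false∣ (true  ∷ B) (suc i) Bi   = cong suc (∣set-false∣ B i Bi)
∣set-false∣ (false ∷ B) (suc i) Bi   = ∣set-false∣ B i Bi

∣replace∣ : ∀ {n} (B : Buffer n) {x a} → lookup B x ≡ true → lookup B a ≡ false → x ≢ a →
            ∣ (B [ x ]≔ false) [ a ]≔ true ∣ ≡ ∣ B ∣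
∣replace∣ B {x} {a} Bx Ba x≢a =
  trans (∣set-true∣ (B [ x ]≔ false) a (trans (lookup∘update′ (x≢a ∘ sym) B false) Ba)) (∣set-false∣ B x Bx)

nonempty : ∀ {n} (B : Buffer n) → 1 ≤ ∣ B ∣ → ∃ λ x → lookup B x ≡ true
nonempty {n} B 1≤∣B∣ with nonempty? B
... | yes (x , x∈B) = x , []=⇒lookup x∈B
... | no  empty     = contradiction (trans (cong ∣_∣ (Empty-unique empty)) (∣⊥∣≡0 n)) (<⇒≢ 1≤∣B∣ ∘ sym)

record OccupancyOf {V} (σ : Stack V) (B : Buffer V) (P : Occupancy) : Set where
  constructor occupancy
  field occupied : ∀ x → P (toℕ x) ≡ lookup B (σ x)
open OccupancyOf

occupancyOf-moveToFront : ∀ {V} {σ : Stack V} {B P} d → OccupancyOf σ B P →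
                          OccupancyOf (moveToFront σ d) B (moveFront P (toℕ d))
occupancyOf-moveToFront {σ = σ} {B} {P} d occ = occupancy λ x →
  let x′ , σx≡ , x′≡ = moveToFront-before σ d x
  in trans (cong P (sym x′≡)) (trans (occupied occ x′) (cong (lookup B) (sym σx≡)))

occupancyOf-set : ∀ {V} {σ : Stack V} {B P} e b → Injective _≡_ _≡_ σ → OccupancyOf σ B P →
                  OccupancyOf σ (B [ σ e ]≔ b) (set P (toℕ e) b)
occupancyOf-set {σ = σ} {B} {P} e b σ-inj occ = occupancy at
  where
  at : ∀ x → set P (toℕ e) b (toℕ x) ≡ lookup (B [ σ e ]≔ b) (σ x)
  at x with x ≟ᶠ e
  ... | yes refl = trans (set-≡ P (toℕ x) b) (sym (lookup∘update (σ x) B b))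
  ... | no  x≢e  = trans (set-≢ P (toℕ e) b (x≢e ∘ toℕ-injective))
      (trans (occupied occ x) (sym (lookup∘update′ (x≢e ∘ σ-inj) B b)))

buffered≢unbuffered : ∀ {n} (B : Buffer n) {a b} → lookup B a ≡ true → lookup B b ≡ false → a ≢ b
buffered≢unbuffered B Ba Bb refl = contradiction (trans (sym Ba) Bb) λ ()

occupancy-at : ∀ {V} {σ : Stack V} {B P} → OccupancyOf σ B P → ∀ x {i b} → toℕ x ≡ i → lookup B (σ x) ≡ b → P i ≡ b
occupancy-at occ x refl σx∈B = trans (occupied occ x) σx∈B

marked-position : ∀ {V} {σ : Stack V} {B P} → Injective _≡_ _≡_ σ → OccupancyOf σ B P → 1 ≤ ∣ B ∣ → ∃ λ e → P (toℕ e) ≡ true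
marked-position {σ = σ} {B} σ-inj occ 1≤∣B∣ =
  let b , Bb   = nonempty B 1≤∣B∣
      e , σe≡b = injective⇒surjective σ σ-inj b
  in e , trans (occupied occ e) (trans (cong (lookup B) σe≡b) Bb)

scanMRU-firstMarked : ∀ {V} {σ : Stack V} {B P} d → OccupancyOf σ B P → lookup B (σ d) ≡ false →
                      ∀ c i (g : Fin c → Fin V) → (∀ j → toℕ (g j) ≡ i ℕ.+ toℕ j) →
                      ∃ λ x → scanMRU σ B (σ d) (tabulate g) ≡ σ x × toℕ x ≡ firstMarked P (toℕ d) c i
scanMRU-firstMarked d occ Bd zero    i g g≡ = d , refl , refl
scanMRU-firstMarked {σ = σ} {B} {P} d occ Bd (suc c) i g g≡ with lookup B (σ (g zero)) in Bg₀
... | true = g zero , scan-hit , trans g₀≡i (cong (if_then i else firstMarked P (toℕ d) c (suc i)) (sym Pi))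
  where
  g₀≡i : toℕ (g zero) ≡ i
  g₀≡i = trans (g≡ zero) (+-identityʳ i)
  Pi : P i ≡ true
  Pi = occupancy-at occ (g zero) g₀≡i Bg₀
  scan-hit : (if not (does (σ (g zero) ≟ᶠ σ d)) then σ (g zero) else scanMRU σ B (σ d) (tabulate (g ∘ suc))) ≡ σ (g zero)
  scan-hit rewrite dec-false (σ (g zero) ≟ᶠ σ d) (buffered≢unbuffered B Bg₀ Bd) = refl
... | false with scanMRU-firstMarked d occ Bd c (suc i) (g ∘ suc) (λ j → trans (g≡ (suc j)) (+-suc i (toℕ j)))
...   | x , scan≡ , x≡ = x , scan≡ , trans x≡ (cong (if_then i else firstMarked P (toℕ d) c (suc i)) (sym Pi))
  where
  Pi : P i ≡ false
  Pi = occupancy-at occ (g zero) (trans (g≡ zero) (+-identityʳ i)) Bg₀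

occupancyAlong : ∀ {V} → Stack V → Buffer V → Occupancy
occupancyAlong {V} σ B j with j <? V
... | yes j<V = lookup B (σ (fromℕ< j<V))
... | no  _   = false

occupancyAlong-correct : ∀ {V} (σ : Stack V) B → OccupancyOf σ B (occupancyAlong σ B)
occupancyAlong-correct {V} σ B = occupancy at
  where
  at : ∀ x → occupancyAlong σ B (toℕ x) ≡ lookup B (σ x)
  at x with toℕ x <? V
  ... | yes x<V = cong (lookup B ∘ σ) (fromℕ<-toℕ x x<V)
  ... | no  x≮V = contradiction (toℕ<n x) x≮V

module Comparison (V C : ℕ) (s : Fin V → ℚ) (s-dist : IsDistribution s) (s-mono : NonDecreasing s) where
  open Model V C s
  open Induction s-dist s-mono

  afterStep : Policy V → ℕ → ℕ → ℚ × Stack V × Buffer V → ℚ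
  afterStep π k t (m , σ′ , B′) = m + expMisses s C π k (suc t) σ′ B′

  module _ (π : Policy V) (t : ℕ) (σ : Stack V) (B : Buffer V) (d : Fin V) where

    step-hit : lookup B (σ d) ≡ true → step C π t σ B d ≡ (0ℚ , moveToFront σ d , B)
    step-hit Bd rewrite Bd = refl

    step-insert : lookup B (σ d) ≡ false → ∣ B ∣ < C → step C π t σ B d ≡ (1ℚ , moveToFront σ d , B [ σ d ]≔ true)
    step-insert Bd n<C rewrite Bd with ∣ B ∣ <ᵇ C | proof (∣ B ∣ <? C)
    ... | _ | ofʸ _   = refl
    ... | _ | ofⁿ n≮C = contradiction n<C n≮C

    step-evict : lookup B (σ d) ≡ false → ¬ ∣ B ∣ < C →
                 step C π t σ B d ≡ (1ℚ , moveToFront σ d , (B [ π t σ B (σ d) ]≔ false) [ σ d ]≔ true)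
    step-evict Bd n≮C rewrite Bd with ∣ B ∣ <ᵇ C | proof (∣ B ∣ <? C)
    ... | _ | ofʸ n<C = contradiction n<C n≮C
    ... | _ | ofⁿ _   = refl

  mru-victim : ∀ {t σ B P} d → OccupancyOf σ B P → lookup B (σ d) ≡ false →
               ∃ λ x → MRU t σ B (σ d) ≡ σ x × toℕ x ≡ victim P (toℕ d)
  mru-victim d occ Bd = scanMRU-firstMarked d occ Bd V 0 id (λ _ → refl)

  mru-≤-cost : ∀ k t σ B P → Injective _≡_ _≡_ σ → OccupancyOf σ B P → ∣ B ∣ ≤ C → 1 ≤ C →
               expMisses s C MRU k t σ B ≤ℚ cost k ∣ B ∣ P
  mru-≤-cost zero    t σ B P σ-inj occ B≤C 1≤C = ≤-refl
  mru-≤-cost (suc k) t σ B P σ-inj occ B≤C 1≤C =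
    expectation-mono-≤ (proj₁ s-dist) λ d → access-≤ d (mark? (lookup B (σ d))) (n <? C)
    where
    open ≤-Reasoning
    n = ∣ B ∣
    access-≤ : ∀ d → Mark (lookup B (σ d)) → Dec (n < C) →
               afterStep MRU k t (step C MRU t σ B d) ≤ℚ stepCost (cost k) n P (toℕ d)
    access-≤ d (marked Bd) _ = begin
      afterStep MRU k t (step C MRU t σ B d)
        ≡⟨ cong (afterStep MRU k t) (step-hit MRU t σ B d Bd) ⟩
      0ℚ + expMisses s C MRU k (suc t) (moveToFront σ d) B
        ≡⟨ +-identityˡ _ ⟩
      expMisses s C MRU k (suc t) (moveToFront σ d) B
        ≤⟨ mru-≤-cost k (suc t) (moveToFront σ d) B (moveFront P (toℕ d)) (moveToFront-injective σ d σ-inj)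
           (occupancyOf-moveToFront d occ) B≤C 1≤C ⟩
      cost k n (moveFront P (toℕ d))
        ≡⟨ stepCost-hit (cost k) n P (toℕ d) (occupancy-at occ d refl Bd) ⟨
      stepCost (cost k) n P (toℕ d) ∎
    access-≤ d (unmarked Bd) (yes n<C) = begin
      afterStep MRU k t (step C MRU t σ B d)
        ≡⟨ cong (afterStep MRU k t) (step-insert MRU t σ B d Bd n<C) ⟩
      1ℚ + expMisses s C MRU k (suc t) (moveToFront σ d) B′
        ≤⟨ +-monoʳ-≤ 1ℚ (mru-≤-cost k (suc t) (moveToFront σ d) B′ (moveFront (set P (toℕ d) true) (toℕ d))
           (moveToFront-injective σ d σ-inj)
           (occupancyOf-moveToFront d (occupancyOf-set d true σ-inj occ)) (subst (_≤ C) (sym ∣B′∣) n<C) 1≤C) ⟩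
      1ℚ + cost k ∣ B′ ∣ (moveFront (set P (toℕ d) true) (toℕ d))
        ≡⟨ cong (λ m → 1ℚ + cost k m _) ∣B′∣ ⟩
      1ℚ + cost k (suc n) (moveFront (set P (toℕ d) true) (toℕ d))
        ≡⟨ stepCost-insert (cost k) n P (toℕ d) (occupancy-at occ d refl Bd) n<C ⟨
      stepCost (cost k) n P (toℕ d) ∎
      where
      B′ = B [ σ d ]≔ true
      ∣B′∣ = ∣set-true∣ B (σ d) Bd
    access-≤ d (unmarked Bd) (no n≮C) with mru-victim {t} d occ Bd
    ... | x , mru≡ , x≡ = begin
      afterStep MRU k t (step C MRU t σ B d)
        ≡⟨ cong (afterStep MRU k t) (step-evict MRU t σ B d Bd n≮C) ⟩
      1ℚ + expMisses s C MRU k (suc t) (moveToFront σ d) B″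
        ≡⟨ cong (λ b → 1ℚ + expMisses s C MRU k (suc t) (moveToFront σ d) ((B [ b ]≔ false) [ σ d ]≔ true)) mru≡ ⟩
      1ℚ + expMisses s C MRU k (suc t) (moveToFront σ d) B′
        ≤⟨ +-monoʳ-≤ 1ℚ (mru-≤-cost k (suc t) (moveToFront σ d) B′ (moveFront (move P (toℕ x) (toℕ d)) (toℕ d))
           (moveToFront-injective σ d σ-inj)
           (occupancyOf-moveToFront d (occupancyOf-set d true σ-inj (occupancyOf-set x false σ-inj occ)))
               (subst (_≤ C) (sym ∣B′∣) B≤C) 1≤C) ⟩
      1ℚ + cost k ∣ B′ ∣ (moveFront (move P (toℕ x) (toℕ d)) (toℕ d))
        ≡⟨ cong₂ (λ m v → 1ℚ + cost k m (moveFront (move P v (toℕ d)) (toℕ d))) ∣B′∣ x≡ ⟩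
      1ℚ + cost k n (moveFront (move P (victim P (toℕ d)) (toℕ d)) (toℕ d))
        ≡⟨ stepCost-evict (cost k) n P (toℕ d) (occupancy-at occ d refl Bd) n≮C ⟨
      stepCost (cost k) n P (toℕ d) ∎
      where
      B″ = (B [ MRU t σ B (σ d) ]≔ false) [ σ d ]≔ true
      B′ = (B [ σ x ]≔ false) [ σ d ]≔ true
      Bx : lookup B (σ x) ≡ true
      Bx with e , Pe ← marked-position σ-inj occ (subst (1 ≤_) (sym (≤-antisym B≤C (≮⇒≥ n≮C))) 1≤C) =
        trans (sym (occupied occ x)) (trans (cong P x≡) (victim-marked P (toℕ d) (toℕ<n e) Pe))
      ∣B′∣ : ∣ B′ ∣ ≡ n
      ∣B′∣ = ∣replace∣ B Bx Bd (buffered≢unbuffered B Bx Bd)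

  cost-≤-misses : ∀ π → ValidPolicy C π → ∀ k t σ B P → Injective _≡_ _≡_ σ → OccupancyOf σ B P → ∣ B ∣ ≤ C →
                  cost k ∣ B ∣ P ≤ℚ expMisses s C π k t σ B
  cost-≤-misses π valid zero    t σ B P σ-inj occ B≤C = ≤-refl
  cost-≤-misses π valid (suc k) t σ B P σ-inj occ B≤C =
    expectation-mono-≤ (proj₁ s-dist) λ d → access-≤ d (mark? (lookup B (σ d))) (n <? C)
    where
    open ≤-Reasoning
    n = ∣ B ∣
    access-≤ : ∀ d → Mark (lookup B (σ d)) → Dec (n < C) →
               stepCost (cost k) n P (toℕ d) ≤ℚ afterStep π k t (step C π t σ B d)
    access-≤ d (marked Bd) _ = begin
      stepCost (cost k) n P (toℕ d)
        ≡⟨ stepCost-hit (cost k) n P (toℕ d) (occupancy-at occ d refl Bd) ⟩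
      cost k n (moveFront P (toℕ d))
        ≤⟨ cost-≤-misses π valid k (suc t) (moveToFront σ d) B (moveFront P (toℕ d)) (moveToFront-injective σ d σ-inj)
           (occupancyOf-moveToFront d occ) B≤C ⟩
      expMisses s C π k (suc t) (moveToFront σ d) B
        ≡⟨ +-identityˡ _ ⟨
      0ℚ + expMisses s C π k (suc t) (moveToFront σ d) B
        ≡⟨ cong (afterStep π k t) (step-hit π t σ B d Bd) ⟨
      afterStep π k t (step C π t σ B d) ∎
    access-≤ d (unmarked Bd) (yes n<C) = begin
      stepCost (cost k) n P (toℕ d)
        ≡⟨ stepCost-insert (cost k) n P (toℕ d) (occupancy-at occ d refl Bd) n<C ⟩
      1ℚ + cost k (suc n) (moveFront (set P (toℕ d) true) (toℕ d))
        ≡⟨ cong (λ m → 1ℚ + cost k m _) ∣B′∣ ⟨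
      1ℚ + cost k ∣ B′ ∣ (moveFront (set P (toℕ d) true) (toℕ d))
        ≤⟨ +-monoʳ-≤ 1ℚ (cost-≤-misses π valid k (suc t) (moveToFront σ d) B′ (moveFront (set P (toℕ d) true) (toℕ d))
           (moveToFront-injective σ d σ-inj) (occupancyOf-moveToFront d (occupancyOf-set d true σ-inj occ))
               (subst (_≤ C) (sym ∣B′∣) n<C)) ⟩
      1ℚ + expMisses s C π k (suc t) (moveToFront σ d) B′
        ≡⟨ cong (afterStep π k t) (step-insert π t σ B d Bd n<C) ⟨
      afterStep π k t (step C π t σ B d) ∎
      where
      B′ = B [ σ d ]≔ true
      ∣B′∣ = ∣set-true∣ B (σ d) Bd
    access-≤ d (unmarked Bd) (no n≮C) = begin
      stepCost (cost k) n P (toℕ d)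
        ≡⟨ stepCost-evict (cost k) n P (toℕ d) Pd n≮C ⟩
      1ℚ + cost k n (moveFront (move P (victim P (toℕ d)) (toℕ d)) (toℕ d))
        ≤⟨ +-monoʳ-≤ 1ℚ (evict-victim-≤ (monotone k) n P (toℕ<n d) (toℕ<n e) Pd Pe) ⟩
      1ℚ + cost k n P′
        ≡⟨ cong (λ m → 1ℚ + cost k m P′) ∣B′∣ ⟨
      1ℚ + cost k ∣ B′ ∣ P′
        ≤⟨ +-monoʳ-≤ 1ℚ (cost-≤-misses π valid k (suc t) (moveToFront σ d) B′ P′ (moveToFront-injective σ d σ-inj)
           (occupancyOf-moveToFront d (occupancyOf-set d true σ-inj (occupancyOf-set e false σ-inj occ)))
               (subst (_≤ C) (sym ∣B′∣) B≤C)) ⟩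
      1ℚ + expMisses s C π k (suc t) (moveToFront σ d) B′
        ≡⟨ cong (λ b → 1ℚ + expMisses s C π k (suc t) (moveToFront σ d) ((B [ b ]≔ false) [ σ d ]≔ true)) σe≡b ⟩
      1ℚ + expMisses s C π k (suc t) (moveToFront σ d) ((B [ b ]≔ false) [ σ d ]≔ true)
        ≡⟨ cong (afterStep π k t) (step-evict π t σ B d Bd n≮C) ⟨
      afterStep π k t (step C π t σ B d) ∎
      where
      Pd = occupancy-at occ d refl Bd
      b = π t σ B (σ d)
      b∈B×b≢σd : (b ∈ B) × (b ≢ σ d)
      b∈B×b≢σd = valid t σ B (σ d) (≤-antisym B≤C (≮⇒≥ n≮C)) (λ σd∈B → contradiction (trans (sym ([]=⇒lookup σd∈B)) Bd) λ ())
      Bb = []=⇒lookup (proj₁ b∈B×b≢σd)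
      e = proj₁ (injective⇒surjective σ σ-inj b)
      σe≡b = proj₂ (injective⇒surjective σ σ-inj b)
      Be = trans (cong (lookup B) σe≡b) Bb
      Pe = occupancy-at occ e refl Be
      P′ = moveFront (move P (toℕ e) (toℕ d)) (toℕ d)
      B′ = (B [ σ e ]≔ false) [ σ d ]≔ true
      ∣B′∣ : ∣ B′ ∣ ≡ n
      ∣B′∣ = ∣replace∣ B Be Bd (λ σe≡σd → proj₂ b∈B×b≢σd (trans (sym σe≡b) σe≡σd))

validPolicy⇒1≤C : ∀ {V C} {π : Policy (suc V)} → ValidPolicy C π → 1 ≤ C
validPolicy⇒1≤C {V} {C = zero}  valid = contradiction (proj₁ (valid 0 id ⊥ zero (∣⊥∣≡0 (suc V)) ∉⊥)) ∉⊥
validPolicy⇒1≤C {C = suc C} valid = s≤s z≤n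

theorem7 : (V : ℕ) (s : Fin V → ℚ) → IsDistribution s → NonDecreasing s →
    (C τ : ℕ) → 1 ≤ τ →
    (σ₀ : Stack V) → Injective _≡_ _≡_ σ₀ →
    (B₀ : Buffer V) → ∣ B₀ ∣ ≤ C →
    (π : Policy V) → ValidPolicy C π →
    expMisses s C MRU τ 0 σ₀ B₀ ≤ℚ expMisses s C π τ 0 σ₀ B₀
theorem7 zero    _ _      _      _ (suc _) _ _  _      _  _    _ _     = ≤-refl
theorem7 (suc V) s s-dist s-mono C τ       _ σ₀ σ₀-inj B₀ B₀≤C π valid = begin
  expMisses s C MRU τ 0 σ₀ B₀
    ≤⟨ mru-≤-cost τ 0 σ₀ B₀ P₀ σ₀-inj occ₀ B₀≤C (validPolicy⇒1≤C valid) ⟩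
  cost τ ∣ B₀ ∣ P₀
    ≤⟨ cost-≤-misses π valid τ 0 σ₀ B₀ P₀ σ₀-inj occ₀ B₀≤C ⟩
  expMisses s C π τ 0 σ₀ B₀ ∎
  where
  open Comparison (suc V) C s s-dist s-mono
  open Model (suc V) C s using (cost)
  open ≤-Reasoning
  P₀ : Occupancy
  P₀ = occupancyAlong σ₀ B₀
  occ₀ : OccupancyOf σ₀ B₀ P₀
  occ₀ = occupancyAlong-correct σ₀ B₀
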